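{- Let $\delta$ be a symbolic 3-dissimilarity on a set $X=\{x,y,z\}$ of size $3$, taking values in $M\cup\{\odot\}$. Then there exists a level-1 representation of $\delta$ if and only if $\delta$ satisfies the Helly-type property, i.e. $\delta(x,y,z)\in\{\delta(x,y),\delta(x,z),\delta(y,z)\}$. In that case there is a unique level-1 representation $\mathcal N=(N,t)$ of $\delta$ that is semi-discriminating and whose underlying network $N$ is, up to a permutation of the leaves, isomorphic to one of the fork, a triplet, or a tricycle on $X$.
   Context: $M$ is a finite set of symbols with $|M|\geq 2$ and $\odot\notin M$. A symbolic 3-dissimilarity on a finite set $X$ is a map $\delta$ from the set of nonempty subsets of $X$ of size at most $3$ to $M\cup\{\odot\}$ such that $\delta(A)=\odot$ iff $|A|=1$; one writes $\delta(a,b)$, $\delta(a,b,c)$. All directed graphs have no loops or multiple edges. A rooted DAG is a directed acyclic graph with a unique vertex of indegree $0$ (its root). A leaf is a vertex of indegree $1$ and outdegree $0$; interior vertices are non-leaves; a hybrid vertex has indegree $2$ and nonzero outdegree; $V(N)^-_{int}$ is the set of interior vertices that are not hybrid. A cycle of a DAG is an induced subgraph whose underlying undirected graph is a cycle. A phylogenetic network on $X$ is a rooted DAG with no vertex of indegree $1$ and outdegree $1$ and leaf set $X$; it is level-1 if every interior vertex lies in at most one cycle. $\mathcal F(v)$ is the set of leaves reachable from $v$ by a directed path; for a level-1 network $N$ and $Y\subseteq X$, $|Y|\ge 2$, $lca_N(Y)$ is the unique interior vertex $v$ with $Y\subseteq\mathcal F(v)$ and $Y\not\subseteq\mathcal F(v')$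 for all children $v'$ of $v$. A labelled level-1 network on $X$ is a pair $(N,t)$ with $N$ a level-1 network on $X$ and $t:V(N)^-_{int}\to M$; it induces $\delta_{(N,t)}(Y)=t(lca_N(Y))$ for $|Y|\in\{2,3\}$ and $\delta_{(N,t)}(Y)=\odot$ for $|Y|=1$. A level-1 representation of $\delta$ is a labelled level-1 network $\mathcal N$ with $\delta_{\mathcal N}=\delta$. It is semi-discriminating if $N$ contains no directed edge $(u,v)$ with $t(u)=t(v)$, except when there is a cycle $C$ of $N$ with $|V(C)\cap\{u,v\}|=1$. Two DAGs with leaf set $X$ are isomorphic if there is a directed-graph isomorphism between them that is the identity on $X$. For distinct $a,b,c$: the fork on $\{a,b,c\}$ is the network whose root has exactly the three leaf children $a,b,c$; the triplet $a|bc$ is the network whose root has children $a$ and a vertex $w$, where $w$ has leaf children $b,c$; the tricycle $a||bc$ is the network with root $\rho$ having children $u,w$, where $u$ has children $b$ and $h$, $w$ has children $c$ and $h$, and $h$ (a hybrid vertex) has the single child $a$. -}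

module Defs where

open import Data.Bool using (Bool; true; false; T; not; _∧_; _∨_; if_then_else_)
open import Data.Nat using (ℕ; zero; suc; _≤_; _≡ᵇ_)
open import Data.Fin using (Fin; toℕ; _↑ʳ_; fromℕ<)
open import Data.Fin.Subset using (Subset; _∈_; ∣_∣; ⁅_⁆; _∪_; ⊤)
open import Data.List using (List; []; _∷_; map; allFin)
open import Data.Bool.ListAction using (any)
open import Data.Nat.ListAction using (sum)
open import Data.Vec using (lookup)
open import Data.Maybe using (Maybe; just; nothing)
open import Data.Product using (Σ; _×_; _,_; ∃; ∃-syntax)
open import Data.Sum using (_⊎_)
open import Relation.Nullary using (¬_)
open import Relation.Binary.PropositionalEquality using (_≡_)
open import Function.Definitions using (Injective)

-- Symbolic 3-dissimilarities on X = Fin n with values in M ∪ {⊙},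
-- where ⊙ is represented by 'nothing' and m ∈ M by 'just m'.
-- δ is given on all subsets; only its values on nonempty subsets of
-- size ≤ 3 matter (the value on ∅ is never used anywhere).

SymDiss : ℕ → Set → Set
SymDiss n M = Subset n → Maybe M

IsSymDiss3 : ∀ {n M} → SymDiss n M → Set
IsSymDiss3 {n} δ = ∀ (A : Subset n) → 1 ≤ ∣ A ∣ → ∣ A ∣ ≤ 3 →
  (δ A ≡ nothing → ∣ A ∣ ≡ 1) × (∣ A ∣ ≡ 1 → δ A ≡ nothing)

pair : ∀ {n} → Fin n → Fin n → Subset n
pair i j = ⁅ i ⁆ ∪ ⁅ j ⁆

-- Finite directed graphs (no loops, no multiple edges: edge relation is
-- a Bool-valued relation) with an embedding of the leaf labels X = Fin n.

record Net (n : ℕ) : Set where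
  field
    k    : ℕ
    E    : Fin k → Fin k → Bool
    leaf : Fin n → Fin k

module _ {n : ℕ} (N : Net n) where
  open Net N

  indeg : Fin k → ℕ
  indeg v = sum (map (λ u → if E u v then 1 else 0) (allFin k))

  outdeg : Fin k → ℕ
  outdeg u = sum (map (λ v → if E u v then 1 else 0) (allFin k))

  isLeaf : Fin k → Bool
  isLeaf v = (indeg v ≡ᵇ 1) ∧ (outdeg v ≡ᵇ 0)

  isHybrid : Fin k → Bool
  isHybrid v = (indeg v ≡ᵇ 2) ∧ not (outdeg v ≡ᵇ 0)

  isInterior : Fin k → Bool
  isInterior v = not (isLeaf v)

  isIntNonHyb : Fin k → Bool
  isIntNonHyb v = isInterior v ∧ not (isHybrid v)

  data Reach : Fin k → Fin k → Set where
    here : ∀ {u} → Reach u u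
    step : ∀ {u w v} → E u w ≡ true → Reach w v → Reach u v

  IsRootedDAG : Set
  IsRootedDAG =
    (∀ v → E v v ≡ false) ×
    (∀ u v → E u v ≡ true → ¬ Reach v u) ×
    (Σ (Fin k) λ r → indeg r ≡ 0 × (∀ v → indeg v ≡ 0 → v ≡ r))

  LeafSetIsX : Set
  LeafSetIsX =
    Injective _≡_ _≡_ leaf ×
    (∀ x → isLeaf (leaf x) ≡ true) ×
    (∀ v → isLeaf v ≡ true → ∃[ x ] leaf x ≡ v)

  IsPhyloNet : Set
  IsPhyloNet = IsRootedDAG × LeafSetIsX ×
    (∀ v → ¬ (indeg v ≡ 1 × outdeg v ≡ 1))

  Adj : Fin k → Fin k → Bool
  Adj u v = E u v ∨ E v u

  degIn : Subset k → Fin k → ℕ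
  degIn S v = sum (map (λ u → if Adj u v ∧ lookup S u then 1 else 0) (allFin k))

  data UPath (S : Subset k) : Fin k → Fin k → Set where
    here : ∀ {u} → UPath S u u
    step : ∀ {u w v} → Adj u w ≡ true → w ∈ S → UPath S w v → UPath S u v

  -- A cycle of N: (the induced subgraph on) a vertex set S whose
  -- underlying undirected graph is a cycle, i.e. |S| ≥ 3, connected,
  -- and every vertex of S has exactly two neighbours in S.
  IsCycle : Subset k → Set
  IsCycle S = 3 ≤ ∣ S ∣ ×
    (∀ v → v ∈ S → degIn S v ≡ 2) ×
    (∀ u v → u ∈ S → v ∈ S → UPath S u v)

  IsLevel1 : Set
  IsLevel1 = IsPhyloNet ×
    (∀ v → isInterior v ≡ true → ∀ S S' → IsCycle S → IsCycle S' →
       v ∈ S → v ∈ S' → S ≡ S')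

  Below : Subset n → Fin k → Set
  Below Y v = ∀ x → x ∈ Y → Reach v (leaf x)

  IsLCA : Subset n → Fin k → Set
  IsLCA Y v = isInterior v ≡ true × Below Y v ×
    (∀ w → E v w ≡ true → ¬ Below Y w)

record LNet (n : ℕ) (M : Set) : Set where
  field
    net : Net n
  open Net net public
  field
    t : (v : Fin k) → T (isIntNonHyb net v) → M

module _ {n : ℕ} {M : Set} (𝒩 : LNet n M) where
  open LNet 𝒩

  -- δ_𝒩 = δ : for every Y with |Y| ∈ {2,3}, lca_N(Y) exists, is unique,
  -- lies in V(N)^-_int and t(lca_N(Y)) = δ(Y).  (For |Y| = 1 both sides
  -- are ⊙ by IsSymDiss3 and the definition of δ_𝒩.)
  Represents : SymDiss n M → Set
  Represents δ = ∀ (Y : Subset n) → 2 ≤ ∣ Y ∣ → ∣ Y ∣ ≤ 3 →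
    Σ (Fin k) λ v → IsLCA net Y v ×
      (∀ v' → IsLCA net Y v' → v' ≡ v) ×
      Σ (T (isIntNonHyb net v)) λ p → just (t v p) ≡ δ Y

  IsLevel1Rep : SymDiss n M → Set
  IsLevel1Rep δ = IsLevel1 net × Represents δ

  SemiDiscriminating : Set
  SemiDiscriminating = ∀ u v → E u v ≡ true →
    (pu : T (isIntNonHyb net u)) (pv : T (isIntNonHyb net v)) →
    t u pu ≡ t v pv →
    Σ (Subset k) λ C → IsCycle net C ×
      ((u ∈ C × ¬ v ∈ C) ⊎ (¬ u ∈ C × v ∈ C))

record NetIso {n : ℕ} (N N' : Net n) : Set where
  module N  = Net N
  module N' = Net N'
  field
    φ   : Fin N.k → Fin N'.k
    ψ   : Fin N'.k → Fin N.k
    ψφ  : ∀ v → ψ (φ v) ≡ v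
    φψ  : ∀ v → φ (ψ v) ≡ v
    edge : ∀ u v → N'.E (φ u) (φ v) ≡ N.E u v
    onX : ∀ x → φ (N.leaf x) ≡ N'.leaf x

record LNetIso {n : ℕ} {M : Set} (𝒩 𝒩' : LNet n M) : Set where
  module A = LNet 𝒩
  module B = LNet 𝒩'
  field
    iso : NetIso A.net B.net
  open NetIso iso
  field
    label : ∀ v (p : T (isIntNonHyb A.net v)) (p' : T (isIntNonHyb B.net (φ v))) →
      B.t (φ v) p' ≡ A.t v p

mkE : ∀ {k} → List (ℕ × ℕ) → Fin k → Fin k → Bool
mkE es u v = any (λ { (a , b) → (toℕ u ≡ᵇ a) ∧ (toℕ v ≡ᵇ b) }) es

Fork : Net 3
Fork = record { k = 4 ; E = mkE ((0 , 1) ∷ (0 , 2) ∷ (0 , 3) ∷ [])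
              ; leaf = 1 ↑ʳ_ }

-- triplet 0|12 : root 0, children w = 1 and leaf 2 (label 0);
-- w has leaf children 3,4 (labels 1,2)
Triplet : Net 3
Triplet = record { k = 5
                 ; E = mkE ((0 , 1) ∷ (0 , 2) ∷ (1 , 3) ∷ (1 , 4) ∷ [])
                 ; leaf = 2 ↑ʳ_ }

-- tricycle 0||12 : ρ = 0, u = 1, w = 2, h = 3, leaves 4,5,6 (labels 0,1,2)
-- ρ→u, ρ→w, u→b, u→h, w→c, w→h, h→a
Tricycle : Net 3
Tricycle = record { k = 7
                  ; E = mkE ((0 , 1) ∷ (0 , 2) ∷ (1 , 5) ∷ (1 , 3) ∷
                             (2 , 6) ∷ (2 , 3) ∷ (3 , 4) ∷ [])
                  ; leaf = 4 ↑ʳ_ }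

permute : (Fin 3 → Fin 3) → Net 3 → Net 3
permute π N = record { k = Net.k N ; E = Net.E N ; leaf = λ x → Net.leaf N (π x) }

StandardShape : Net 3 → Set
StandardShape N = Σ (Fin 3 → Fin 3) λ π → Injective _≡_ _≡_ π ×
  (NetIso N (permute π Fork) ⊎ NetIso N (permute π Triplet)
     ⊎ NetIso N (permute π Tricycle))

x₀ y₀ z₀ : Fin 3
x₀ = fromℕ< {0} (Data.Nat.s≤s Data.Nat.z≤n)
y₀ = fromℕ< {1} (Data.Nat.s≤s (Data.Nat.s≤s Data.Nat.z≤n))
z₀ = fromℕ< {2} (Data.Nat.s≤s (Data.Nat.s≤s (Data.Nat.s≤s Data.Nat.z≤n)))

Helly : ∀ {M} → SymDiss 3 M → Set
Helly δ = (δ ⊤ ≡ δ (pair x₀ y₀)) ⊎ (δ ⊤ ≡ δ (pair x₀ z₀)) ⊎ (δ ⊤ ≡ δ (pair y₀ z₀))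

module Submission where

-- Necessity (HellyNecessary): if δ(X) differed from the value of all three
-- pairs, each pair would sit below a different child of lca(X); these
-- children pairwise share a leaf, so the walks joining them avoid
-- lca(X) and close two distinct cycles through it, against level-1
-- (Cycles builds an induced cycle from such a walk).
-- Sufficiency and uniqueness (Candidates, Uniqueness): the Helly property
-- says that the pattern "which pairs have the value of X" is that of one
-- of seven candidate networks; that candidate, labelled by δ, is a
-- semi-discriminating level-1 representation (checked by evaluation,
-- Criteria).  Conversely, a semi-discriminating representation of
-- standard shape is isomorphic to a candidate and forces δ to have its
-- pattern, so it is the same candidate; labels then agree since every
-- labelled vertex is an lca (Isomorphisms transports lcas and cycles).

open import Defs
open import Data.Nat using (ℕ; _≤_; z≤n; s≤s)
open import Data.Nat.Properties using (≤-trans)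
open import Data.Fin using (Fin)
open import Data.Fin.Properties using () renaming (_≟_ to _≟-Fin_)
open import Data.Fin.Subset using (Subset; ∣_∣; ⊤)
open import Data.Maybe using (Maybe; just; nothing)
open import Data.Maybe.Properties using (≡-dec)
open import Data.Product using (Σ; _×_; _,_; proj₁; proj₂)
open import Data.Sum using (inj₁; inj₂)
open import Data.Empty using (⊥-elim)
open import Relation.Nullary using (¬_; yes; no)
open import Relation.Binary.PropositionalEquality using (_≡_; refl; sym)
open import Relation.Binary.Definitions using (DecidableEquality)
open import Function.Bundles using (_⇔_; mk⇔)

module Prelude where

  open import Data.Bool using (Bool; true; false; T; not; _∧_; _∨_; if_then_else_)
  open import Data.Bool.Properties using (∧-identityʳ)
  open import Data.Nat using (ℕ; zero; suc; _+_; _≤_; z≤n; s≤s)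
  open import Data.Nat.Properties using (+-comm; +-assoc; +-0-commutativeMonoid)
  open import Data.Fin using (Fin; zero; suc)
  open import Data.Fin.Subset using (Subset; ∣_∣)
  open import Data.List using (map; allFin)
  open import Data.List.Properties using (map-tabulate)
  open import Data.Nat.ListAction using (sum)
  open import Data.Vec using (lookup; []; _∷_)
  open import Data.Product using (Σ; _,_)
  open import Data.Sum using (_⊎_; inj₁; inj₂)
  open import Data.Empty using (⊥; ⊥-elim)
  open import Data.Unit using (tt)
  open import Relation.Nullary using (¬_)
  open import Relation.Binary.PropositionalEquality
  import Data.Fin.Permutation as Perm
  import Algebra.Properties.CommutativeMonoid.Sum as MonoidSum

  T⇒≡ : ∀ {b} → T b → b ≡ true
  T⇒≡ {true} _ = refl

  ≡⇒T : ∀ {b} → b ≡ true → T b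
  ≡⇒T refl = tt

  ∧-intro : ∀ {a b} → a ≡ true → b ≡ true → (a ∧ b) ≡ true
  ∧-intro refl refl = refl

  ∧-fst : ∀ {a b} → (a ∧ b) ≡ true → a ≡ true
  ∧-fst {true} _ = refl

  ∧-snd : ∀ {a b} → (a ∧ b) ≡ true → b ≡ true
  ∧-snd {true} e = e

  ∨-inr : ∀ {a b} → b ≡ true → (a ∨ b) ≡ true
  ∨-inr {true} _ = refl
  ∨-inr {false} e = e

  ∨-elim : ∀ a b → (a ∨ b) ≡ true → a ≡ true ⊎ b ≡ true
  ∨-elim true b _ = inj₁ refl
  ∨-elim false b e = inj₂ e

  ⇒-elim : ∀ {x y} → (not x ∨ y) ≡ true → x ≡ true → y ≡ true
  ⇒-elim {true} e refl = e

  not-true : ∀ {x} → not x ≡ true → x ≡ true → ⊥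
  not-true {true} () refl

  not-true⇒false : ∀ {x} → not x ≡ true → x ≡ false
  not-true⇒false {false} _ = refl

  not-false : ∀ {x} → x ≡ false → not x ≡ true
  not-false refl = refl

  not-of-true : ∀ {x} → x ≡ true → not x ≡ false
  not-of-true refl = refl

  true≢false : ¬ true ≡ false
  true≢false ()

  _⇔ᵇ_ : Bool → Bool → Bool
  true ⇔ᵇ b = b
  false ⇔ᵇ b = not b

  ⇔ᵇ-sound : ∀ a b → (a ⇔ᵇ b) ≡ true → a ≡ b
  ⇔ᵇ-sound true true _ = refl
  ⇔ᵇ-sound false false _ = refl

  -- Boolean equality on Fin; it evaluates by pattern matching, which is
  -- what makes the finite checks below compute.

  eqF : ∀ {k} → Fin k → Fin k → Bool
  eqF zero zero = true
  eqF zero (suc _) = false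
  eqF (suc _) zero = false
  eqF (suc x) (suc y) = eqF x y

  eqF-refl : ∀ {k} (x : Fin k) → eqF x x ≡ true
  eqF-refl zero = refl
  eqF-refl (suc x) = eqF-refl x

  eqF-sound : ∀ {k} (x y : Fin k) → eqF x y ≡ true → x ≡ y
  eqF-sound zero zero _ = refl
  eqF-sound (suc x) (suc y) e = cong suc (eqF-sound x y e)

  eqF-≢ : ∀ {k} (x y : Fin k) → ¬ x ≡ y → eqF x y ≡ false
  eqF-≢ zero zero ne = ⊥-elim (ne refl)
  eqF-≢ zero (suc y) ne = refl
  eqF-≢ (suc x) zero ne = refl
  eqF-≢ (suc x) (suc y) ne = eqF-≢ x y (λ e → ne (cong suc e))

  -- Bounded quantifiers over Fin k and over Subset k, with soundness and
  -- completeness: a property of a concrete finite network is proved by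
  -- letting one of them evaluate to true.

  allF : ∀ k → (Fin k → Bool) → Bool
  allF zero f = true
  allF (suc k) f = f zero ∧ allF k (λ i → f (suc i))

  allF-sound : ∀ k (f : Fin k → Bool) → T (allF k f) → ∀ i → f i ≡ true
  allF-sound (suc k) f p zero = ∧-fst {f zero} (T⇒≡ p)
  allF-sound (suc k) f p (suc i) =
    allF-sound k (λ j → f (suc j)) (≡⇒T (∧-snd {f zero} (T⇒≡ p))) i

  allF-complete : ∀ k (f : Fin k → Bool) → (∀ i → f i ≡ true) → allF k f ≡ true
  allF-complete zero f h = refl
  allF-complete (suc k) f h rewrite h zero = allF-complete k (λ i → f (suc i)) (λ i → h (suc i))

  allF²-sound : ∀ k l (f : Fin k → Fin l → Bool) →
    T (allF k λ i → allF l (f i)) → ∀ i j → f i j ≡ true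
  allF²-sound k l f p i = allF-sound l (f i) (≡⇒T (allF-sound k _ p i))

  anyF : ∀ k → (Fin k → Bool) → Bool
  anyF zero f = false
  anyF (suc k) f = f zero ∨ anyF k (λ i → f (suc i))

  anyF-sound : ∀ k (f : Fin k → Bool) → anyF k f ≡ true → Σ (Fin k) λ i → f i ≡ true
  anyF-sound (suc k) f e with f zero in fz
  ... | true = zero , fz
  ... | false with anyF-sound k (λ i → f (suc i)) e
  ... | i , q = suc i , q

  anyF-complete : ∀ k (f : Fin k → Bool) i → f i ≡ true → anyF k f ≡ true
  anyF-complete (suc k) f zero e rewrite e = refl
  anyF-complete (suc k) f (suc i) e = ∨-inr {f zero} (anyF-complete k (λ j → f (suc j)) i e)

  allSubsets : ∀ k → (Subset k → Bool) → Bool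
  allSubsets zero P = P []
  allSubsets (suc k) P = allSubsets k (λ S → P (true ∷ S)) ∧ allSubsets k (λ S → P (false ∷ S))

  allSubsets-sound : ∀ k (P : Subset k → Bool) → T (allSubsets k P) → ∀ S → P S ≡ true
  allSubsets-sound zero P p [] = T⇒≡ p
  allSubsets-sound (suc k) P p (true ∷ S) =
    allSubsets-sound k _ (≡⇒T (∧-fst {allSubsets k (λ S → P (true ∷ S))} (T⇒≡ p))) S
  allSubsets-sound (suc k) P p (false ∷ S) =
    allSubsets-sound k _ (≡⇒T (∧-snd {allSubsets k (λ S → P (true ∷ S))} (T⇒≡ p))) S

  ind : Bool → ℕ
  ind b = if b then 1 else 0

  ΣF : (k : ℕ) → (Fin k → ℕ) → ℕ
  ΣF k g = sum (map g (allFin k))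

  ΣF-suc : ∀ k (g : Fin (suc k) → ℕ) → ΣF (suc k) g ≡ g zero + ΣF k (λ i → g (suc i))
  ΣF-suc k g = cong (λ l → g zero + sum l)
    (trans (map-tabulate suc g) (sym (map-tabulate (λ i → i) (λ i → g (suc i)))))

  ΣF-cong : ∀ k {f g : Fin k → ℕ} → (∀ i → f i ≡ g i) → ΣF k f ≡ ΣF k g
  ΣF-cong zero h = refl
  ΣF-cong (suc k) {f} {g} h = begin
    ΣF (suc k) f                       ≡⟨ ΣF-suc k f ⟩
    f zero + ΣF k (λ i → f (suc i))    ≡⟨ cong₂ _+_ (h zero) (ΣF-cong k (λ i → h (suc i))) ⟩
    g zero + ΣF k (λ i → g (suc i))    ≡⟨ ΣF-suc k g ⟨
    ΣF (suc k) g                       ∎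
    where open ≡-Reasoning

  ΣF-reindex : ∀ a b (φ : Fin a → Fin b) (ψ : Fin b → Fin a) →
    (∀ x → ψ (φ x) ≡ x) → (∀ y → φ (ψ y) ≡ y) →
    (g : Fin b → ℕ) → ΣF b g ≡ ΣF a (λ x → g (φ x))
  ΣF-reindex a b φ ψ ψφ φψ g =
    trans (ΣF-monoidSum b g)
      (trans (sum-permute g (Perm.permutation φ ψ φψ ψφ)) (sym (ΣF-monoidSum a (λ x → g (φ x)))))
    where
    open MonoidSum +-0-commutativeMonoid using (sum-permute) renaming (sum to monoidSum)
    ΣF-monoidSum : ∀ k (g : Fin k → ℕ) → ΣF k g ≡ monoidSum g
    ΣF-monoidSum zero g = refl
    ΣF-monoidSum (suc k) g = trans (ΣF-suc k g) (cong (g zero +_) (ΣF-monoidSum k (λ i → g (suc i))))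

  without : ∀ {k} → (Fin k → Bool) → Fin k → Fin k → Bool
  without f a w = f w ∧ not (eqF w a)

  count-split : ∀ k (f : Fin k → Bool) (a : Fin k) →
    ΣF k (λ w → ind (f w)) ≡ ind (f a) + ΣF k (λ w → ind (without f a w))
  count-split (suc k) f zero = begin
    ΣF (suc k) (λ w → ind (f w))
      ≡⟨ ΣF-suc k _ ⟩
    ind (f zero) + ΣF k (λ i → ind (f (suc i)))
      ≡⟨ cong (ind (f zero) +_) (ΣF-cong k (λ i → cong ind (sym (∧-identityʳ (f (suc i)))))) ⟩
    ind (f zero) + ΣF k (λ i → ind (without f zero (suc i)))
      ≡⟨ cong (λ z → ind (f zero) + (z + ΣF k (λ i → ind (without f zero (suc i))))) (drop-zero (f zero)) ⟨
    ind (f zero) + (ind (without f zero zero) + ΣF k (λ i → ind (without f zero (suc i))))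
      ≡⟨ cong (ind (f zero) +_) (ΣF-suc k _) ⟨
    ind (f zero) + ΣF (suc k) (λ w → ind (without f zero w)) ∎
    where
    open ≡-Reasoning
    drop-zero : ∀ b → ind (b ∧ false) ≡ 0
    drop-zero true = refl
    drop-zero false = refl
  count-split (suc k) f (suc a) = begin
    ΣF (suc k) (λ w → ind (f w))
      ≡⟨ ΣF-suc k _ ⟩
    ind (f zero) + ΣF k (λ i → ind (f (suc i)))
      ≡⟨ cong (ind (f zero) +_) (count-split k f' a) ⟩
    ind (f zero) + (ind (f (suc a)) + rest)
      ≡⟨ sym (+-assoc (ind (f zero)) _ rest) ⟩
    (ind (f zero) + ind (f (suc a))) + rest
      ≡⟨ cong (_+ rest) (+-comm (ind (f zero)) (ind (f (suc a)))) ⟩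
    (ind (f (suc a)) + ind (f zero)) + rest
      ≡⟨ +-assoc (ind (f (suc a))) (ind (f zero)) rest ⟩
    ind (f (suc a)) + (ind (f zero) + rest)
      ≡⟨ cong (λ z → ind (f (suc a)) + (ind z + rest)) (∧-identityʳ (f zero)) ⟨
    ind (f (suc a)) + (ind (without f (suc a) zero) + rest)
      ≡⟨ cong (ind (f (suc a)) +_) (ΣF-suc k _) ⟨
    ind (f (suc a)) + ΣF (suc k) (λ w → ind (without f (suc a) w)) ∎
    where
    open ≡-Reasoning
    f' : Fin k → Bool
    f' i = f (suc i)
    rest : ℕ
    rest = ΣF k (λ w → ind (without f' a w))

  count-none : ∀ k (f : Fin k → Bool) → (∀ w → f w ≡ false) → ΣF k (λ w → ind (f w)) ≡ 0
  count-none zero f h = refl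
  count-none (suc k) f h = trans (ΣF-suc k (λ w → ind (f w)))
    (cong₂ _+_ (cong ind (h zero)) (count-none k (λ i → f (suc i)) (λ i → h (suc i))))

  count-one : ∀ k (f : Fin k → Bool) a → f a ≡ true → (∀ w → f w ≡ true → w ≡ a) →
    ΣF k (λ w → ind (f w)) ≡ 1
  count-one k f a fa only = trans (count-split k f a)
    (cong₂ _+_ (cong ind fa) (count-none k (without f a) others))
    where
    others : ∀ w → without f a w ≡ false
    others w with f w in fw
    ... | false = refl
    ... | true = not-of-true (subst (λ u → eqF w u ≡ true) (only w fw) (eqF-refl w))

  count-two : ∀ k (f : Fin k → Bool) a b → ¬ a ≡ b → f a ≡ true → f b ≡ true →
    (∀ w → f w ≡ true → w ≡ a ⊎ w ≡ b) → ΣF k (λ w → ind (f w)) ≡ 2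
  count-two k f a b a≢b fa fb only = trans (count-split k f a)
    (cong₂ _+_ (cong ind fa) (count-one k (without f a) b b-kept b-only))
    where
    b-kept : without f a b ≡ true
    b-kept rewrite fb | eqF-≢ b a (λ e → a≢b (sym e)) = refl
    b-only : ∀ w → without f a w ≡ true → w ≡ b
    b-only w e with f w in fw | eqF w a in wa
    b-only w () | false | _
    b-only w () | true | true
    ... | true | false with only w fw
    ... | inj₁ refl = ⊥-elim (true≢false (trans (sym (eqF-refl w)) wa))
    ... | inj₂ q = q

  count-three≤ : ∀ k (f : Fin k → Bool) a b c → ¬ a ≡ b → ¬ a ≡ c → ¬ b ≡ c →
    f a ≡ true → f b ≡ true → f c ≡ true → 3 ≤ ΣF k (λ w → ind (f w))
  count-three≤ k f a b c ab ac bc fa fb fc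
    rewrite count-split k f a | fa | count-split k (without f a) b
          | count-split k (without (without f a) b) c
          | fb | fc | eqF-≢ b a (λ e → ab (sym e)) | eqF-≢ c a (λ e → ac (sym e))
          | eqF-≢ c b (λ e → bc (sym e)) = s≤s (s≤s (s≤s z≤n))

  ∣∣-as-count : ∀ {k} (S : Subset k) → ∣ S ∣ ≡ ΣF k (λ w → ind (lookup S w))
  ∣∣-as-count [] = refl
  ∣∣-as-count {suc k} (true ∷ S) =
    trans (cong suc (∣∣-as-count S)) (sym (ΣF-suc k (λ w → ind (lookup (true ∷ S) w))))
  ∣∣-as-count {suc k} (false ∷ S) =
    trans (∣∣-as-count S) (sym (ΣF-suc k (λ w → ind (lookup (false ∷ S) w))))

module Cycles where

  open Prelude
  open import Data.Bool using (Bool; true; false; not; _∧_; _∨_; if_then_else_)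
  open import Data.Bool.Properties using (∨-comm)
  open import Data.Nat using (ℕ; zero; suc; _+_; _∸_; _≤_; _<_; z≤n; s≤s; _≤ᵇ_)
  open import Data.Nat.Properties
    using (≤-refl; ≤-trans; <-trans; <-irrefl; <-≤-trans; <-cmp; <⇒≤; ≤-pred; n≤1+n; n<1+n; 1+n≰n;
           m≤n⇒m<n∨m≡n; m≤n+m; m<m+n; m∸n+n≡m; m∸n≤m; m+[n∸m]≡n; m<n⇒0<n∸m; n≢0⇒n>0;
           +-cancelʳ-≤; +-monoˡ-<; ≤⇒≤ᵇ; ≤ᵇ⇒≤)
  open import Data.Fin using (Fin; zero; suc)
  open import Data.Fin.Properties using (_≟_)
  open import Data.Fin.Subset using (Subset; _∈_; ∣_∣)
  open import Data.Vec using (lookup; tabulate)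
  open import Data.Vec.Properties using (lookup∘tabulate; []=⇒lookup; lookup⇒[]=)
  open import Data.Product using (Σ; _×_; _,_)
  open import Data.Sum using (_⊎_; inj₁; inj₂; [_,_])
  open import Data.Empty using (⊥; ⊥-elim)
  open import Relation.Nullary using (¬_; yes; no)
  open import Relation.Binary.PropositionalEquality using (_≡_; refl; sym; trans; cong; subst)
  open import Relation.Binary.Definitions using (tri<; tri≈; tri>)

  -- The goal
  -- is no-three-linked-children: a vertex lying on at most one cycle has
  -- no three children one of which is joined to the other two by walks
  -- avoiding it, since those walks would close two cycles through it.
  module Walks {n : ℕ} (N : Net n) (noLoop : ∀ v → Net.E N v v ≡ false) where
    open Net N

    Adj-irrefl : ∀ u → Adj N u u ≡ false
    Adj-irrefl u rewrite noLoop u = refl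

    Adj-sym : ∀ {u w} → Adj N u w ≡ true → Adj N w u ≡ true
    Adj-sym {u} {w} e = trans (∨-comm (E w u) (E u w)) e

    E⇒Adj : ∀ {u w} → E u w ≡ true → Adj N u w ≡ true
    E⇒Adj e rewrite e = refl

    data Walk (P : Fin k → Set) : Fin k → Fin k → Set where
      [_]ʷ : ∀ {a} → P a → Walk P a a
      _∷⟨_⟩_ : ∀ {a b c} → P a → Adj N a b ≡ true → Walk P b c → Walk P a c

    walk-head : ∀ {P a b} → Walk P a b → P a
    walk-head [ pa ]ʷ = pa
    walk-head (pa ∷⟨ _ ⟩ _) = pa

    _++ʷ_ : ∀ {P a b c} → Walk P a b → Walk P b c → Walk P a c
    [ _ ]ʷ ++ʷ w' = w'
    (pa ∷⟨ e ⟩ w) ++ʷ w' = pa ∷⟨ e ⟩ (w ++ʷ w')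

    reverseʷ : ∀ {P a b} → Walk P a b → Walk P b a
    reverseʷ [ pa ]ʷ = [ pa ]ʷ
    reverseʷ (pa ∷⟨ e ⟩ w) = reverseʷ w ++ʷ (walk-head w ∷⟨ Adj-sym e ⟩ [ pa ]ʷ)

    mapʷ : ∀ {P Q : Fin k → Set} {a b} → (∀ {x} → P x → Q x) → Walk P a b → Walk Q a b
    mapʷ f [ pa ]ʷ = [ f pa ]ʷ
    mapʷ f (pa ∷⟨ e ⟩ w) = f pa ∷⟨ e ⟩ mapʷ f w

    fromReach : ∀ {u w} → Reach N u w → Walk (Reach N u) u w
    fromReach here = [ here ]ʷ
    fromReach (step e r) = here ∷⟨ E⇒Adj e ⟩ mapʷ (step e) (fromReach r)

    walk-length : ∀ {P a b} → Walk P a b → ℕ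
    walk-length [ _ ]ʷ = 0
    walk-length (_ ∷⟨ _ ⟩ w) = suc (walk-length w)

    walk-at : ∀ {P a b} → Walk P a b → ℕ → Fin k
    walk-at ([_]ʷ {a} _) t = a
    walk-at (_∷⟨_⟩_ {a} _ _ w) zero = a
    walk-at (_ ∷⟨ _ ⟩ w) (suc t) = walk-at w t

    walk-at-start : ∀ {P a b} (w : Walk P a b) → walk-at w 0 ≡ a
    walk-at-start [ _ ]ʷ = refl
    walk-at-start (_ ∷⟨ _ ⟩ _) = refl

    walk-at-end : ∀ {P a b} (w : Walk P a b) → walk-at w (walk-length w) ≡ b
    walk-at-end [ _ ]ʷ = refl
    walk-at-end (_ ∷⟨ _ ⟩ w) = walk-at-end w

    walk-at-adj : ∀ {P a b} (w : Walk P a b) t → t < walk-length w →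
      Adj N (walk-at w t) (walk-at w (suc t)) ≡ true
    walk-at-adj (_ ∷⟨ e ⟩ w) zero _ rewrite walk-at-start w = e
    walk-at-adj (_ ∷⟨ _ ⟩ w) (suc t) (s≤s lt) = walk-at-adj w t lt

    walk-at-P : ∀ {P a b} (w : Walk P a b) t → P (walk-at w t)
    walk-at-P [ pa ]ʷ t = pa
    walk-at-P (pa ∷⟨ _ ⟩ _) zero = pa
    walk-at-P (_ ∷⟨ _ ⟩ w) (suc t) = walk-at-P w t

    anyℕ : ℕ → (ℕ → Bool) → Bool
    anyℕ zero f = false
    anyℕ (suc m) f = f m ∨ anyℕ m f

    anyℕ-sound : ∀ m f → anyℕ m f ≡ true → Σ ℕ λ i → i < m × f i ≡ true
    anyℕ-sound (suc m) f e with f m in fm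
    ... | true = m , ≤-refl , fm
    ... | false with anyℕ-sound m f e
    ... | i , lt , q = i , ≤-trans lt (n≤1+n m) , q

    anyℕ-false : ∀ m f → anyℕ m f ≡ false → ∀ i → i < m → f i ≡ false
    anyℕ-false (suc m) f e i lt with f m in fm
    anyℕ-false (suc m) f () i lt | true
    ... | false with m≤n⇒m<n∨m≡n (≤-pred lt)
    ... | inj₁ lt' = anyℕ-false m f e i lt'
    ... | inj₂ refl = fm

    anyℕ-complete : ∀ m f i → i < m → f i ≡ true → anyℕ m f ≡ true
    anyℕ-complete (suc m) f i lt fi with f m in fm
    ... | true = refl
    ... | false with m≤n⇒m<n∨m≡n (≤-pred lt)
    ... | inj₁ lt' = anyℕ-complete m f i lt' fi
    ... | inj₂ refl = ⊥-elim (true≢false (trans (sym fi) fm))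

    -- Paths that start at a neighbour c of v, avoid v and end at another
    -- neighbour of v.  Removing repetitions and chords turns such a path,
    -- together with v, into an induced cycle.
    module PathsAround (v c : Fin k) where
      isTarget : Fin k → Bool
      isTarget u = Adj N v u ∧ not (eqF u c)

      record Path : Set where
        field
          len    : ℕ
          at     : ℕ → Fin k
          starts : at 0 ≡ c
          ends   : isTarget (at len) ≡ true
          steps  : ∀ t → t < len → Adj N (at t) (at (suc t)) ≡ true
          avoids : ∀ t → ¬ at t ≡ v

      fromWalk : ∀ {b} → (w : Walk (λ x → ¬ x ≡ v) c b) → isTarget b ≡ true → Path
      fromWalk w tb = record
        { len = walk-length w ; at = walk-at w ; starts = walk-at-start w
        ; ends = subst (λ z → isTarget z ≡ true) (sym (walk-at-end w)) tb
        ; steps = walk-at-adj w ; avoids = walk-at-P w }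

      module _ (w : Path) where
        open Path w

        cut-at : ∀ i → i < len → isTarget (at i) ≡ true → Path
        cut-at i il ti = record
          { len = i ; at = at ; starts = starts ; ends = ti
          ; steps = λ t lt → steps t (<-trans lt il) ; avoids = avoids }

        bypass : ∀ i d → 1 ≤ d → suc i + d ≤ len → Adj N (at i) (at (suc i + d)) ≡ true →
          Σ Path λ w' → Path.len w' < len
        bypass i d d≥1 le a = w' , shorter
          where
          at' : ℕ → Fin k
          at' t = if t ≤ᵇ i then at t else at (t + d)
          len' : ℕ
          len' = len ∸ d
          len'+d : len' + d ≡ len
          len'+d = m∸n+n≡m (≤-trans (m≤n+m d (suc i)) le)
          at'-low : ∀ t → t ≤ i → at' t ≡ at t
          at'-low t tl rewrite T⇒≡ (≤⇒≤ᵇ tl) = refl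
          at'-high : ∀ t → i < t → at' t ≡ at (t + d)
          at'-high t it with t ≤ᵇ i in e
          ... | false = refl
          ... | true = ⊥-elim (<-irrefl refl (<-≤-trans it (≤ᵇ⇒≤ t i (≡⇒T e))))
          i<len' : i < len'
          i<len' = +-cancelʳ-≤ d (suc i) len' (subst (suc i + d ≤_) (sym len'+d) le)
          shorter : len' < len
          shorter = subst (len' <_) len'+d (m<m+n len' d≥1)
          avoids' : ∀ t → ¬ at' t ≡ v
          avoids' t with t ≤ᵇ i
          ... | true = avoids t
          ... | false = avoids (t + d)
          steps' : ∀ t → t < len' → Adj N (at' t) (at' (suc t)) ≡ true
          steps' t tl with <-cmp t i
          ... | tri< ti _ _ rewrite at'-low t (<⇒≤ ti) | at'-low (suc t) ti =
                steps t (<-trans ti (<-≤-trans i<len' (m∸n≤m len d)))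
          ... | tri≈ _ refl _ rewrite at'-low t ≤-refl | at'-high (suc t) (n<1+n t) = a
          ... | tri> _ _ it rewrite at'-high t it | at'-high (suc t) (<-trans it (n<1+n t)) =
                steps (t + d) (subst (t + d <_) len'+d (+-monoˡ-< d tl))
          w' : Path
          w' = record
            { len = len' ; at = at' ; starts = trans (at'-low 0 z≤n) starts
            ; ends = subst (λ z → isTarget z ≡ true)
                       (sym (trans (at'-high len' i<len') (cong at len'+d))) ends
            ; steps = steps' ; avoids = avoids' }

      record Chordless (w : Path) : Set where
        open Path w
        field
          no-early-target : ∀ i → i < len → isTarget (at i) ≡ false
          distinct        : ∀ i j → i < j → j < len → ¬ at i ≡ at j
          no-chord        : ∀ i j → suc (suc i) ≤ j → j ≤ len → Adj N (at i) (at j) ≡ false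

      i+1+[j∸i]≡j+1 : ∀ {i j} → i < j → suc i + (j ∸ i) ≡ suc j
      i+1+[j∸i]≡j+1 ij = cong suc (m+[n∸m]≡n (<⇒≤ ij))

      module Defects (w : Path) where
        open Path w

        early-target : Bool
        early-target = anyℕ len (λ i → isTarget (at i))

        repetition : Bool
        repetition = anyℕ len (λ j → anyℕ j (λ i → eqF (at i) (at j)))

        chord : Bool
        chord = anyℕ (suc len) (λ j → anyℕ (j ∸ 1) (λ i → Adj N (at i) (at j)))

        remove-early-target : early-target ≡ true → Σ Path λ w' → Path.len w' < len
        remove-early-target e with anyℕ-sound len _ e
        ... | i , il , ti = cut-at w i il ti , il

        -- at i ≡ at j with i < j: go from at i directly to at (j + 1)
        remove-repetition : repetition ≡ true → Σ Path λ w' → Path.len w' < len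
        remove-repetition e with anyℕ-sound len _ e
        ... | j , jl , e' with anyℕ-sound j _ e'
        ... | i , ij , same =
          bypass w i (j ∸ i) (m<n⇒0<n∸m ij) (subst (_≤ len) (sym (i+1+[j∸i]≡j+1 ij)) jl)
            (subst (λ z → Adj N (at i) (at z) ≡ true) (sym (i+1+[j∸i]≡j+1 ij))
              (subst (λ z → Adj N z (at (suc j)) ≡ true) (sym (eqF-sound _ _ same)) (steps j jl)))

        remove-chord : chord ≡ true → Σ Path λ w' → Path.len w' < len
        remove-chord e with anyℕ-sound (suc len) _ e
        ... | zero , jl , ()
        ... | suc j , jl , e' with anyℕ-sound j _ e'
        ... | i , ij , a =
          bypass w i (j ∸ i) (m<n⇒0<n∸m ij) (subst (_≤ len) (sym (i+1+[j∸i]≡j+1 ij)) (≤-pred jl))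
            (subst (λ z → Adj N (at i) (at z) ≡ true) (sym (i+1+[j∸i]≡j+1 ij)) a)

        no-defect : early-target ≡ false → repetition ≡ false → chord ≡ false → Chordless w
        no-defect e r c = record
          { no-early-target = anyℕ-false _ _ e
          ; distinct = λ i j ij jl eq → true≢false
              (trans (sym (subst (λ z → eqF z (at j) ≡ true) (sym eq) (eqF-refl (at j))))
                     (anyℕ-false j _ (anyℕ-false _ _ r j jl) i ij))
          ; no-chord = λ { i (suc j) (s≤s ij) jl →
              anyℕ-false j _ (anyℕ-false _ _ c (suc j) (s≤s jl)) i ij } }

        shorten-or-chordless : (Σ Path λ w' → Path.len w' < len) ⊎ Chordless w
        shorten-or-chordless with early-target in e | repetition in r | chord in c
        ... | true  | _     | _     = inj₁ (remove-early-target e)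
        ... | false | true  | _     = inj₁ (remove-repetition r)
        ... | false | false | true  = inj₁ (remove-chord c)
        ... | false | false | false = inj₂ (no-defect e r c)

      -- remove defects while there are any; each removal shortens the
      -- path, so fuel len + 1 suffices
      make-chordless : ∀ fuel (w : Path) → Path.len w < fuel → Σ Path Chordless
      make-chordless (suc fuel) w lt with Defects.shorten-or-chordless w
      ... | inj₁ (w' , lt') = make-chordless fuel w' (<-≤-trans lt' (≤-pred lt))
      ... | inj₂ ch = w , ch

      non-target-neighbour : ∀ u → Adj N v u ≡ true → isTarget u ≡ false → eqF u c ≡ true
      non-target-neighbour u vu nt with Adj N v u | eqF u c
      ... | true | true = refl
      non-target-neighbour u () nt | false | _

      -- The vertex set {v} ∪ {at t | t ≤ len} of a chordless path is an
      -- induced cycle through v, in which v has exactly the neighbours c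
      -- and at len.
      module InducedCycle (w : Path) (ch : Chordless w) (vc : Adj N v c ≡ true) where
        open Path w
        open Chordless ch

        len≢0 : ¬ len ≡ 0
        len≢0 e with trans (cong isTarget (sym starts)) (subst (λ z → isTarget (at z) ≡ true) e ends)
        ... | h with ∧-snd {Adj N v c} h
        ... | h' rewrite eqF-refl c = true≢false (sym h')

        1≤len : 1 ≤ len
        1≤len = n≢0⇒n>0 len≢0

        distinct≤ : ∀ i j → i < j → j ≤ len → ¬ at i ≡ at j
        distinct≤ i j ij jl eq with m≤n⇒m<n∨m≡n jl
        ... | inj₁ jl' = distinct i j ij jl' eq
        ... | inj₂ refl = true≢false
              (trans (sym (subst (λ z → isTarget z ≡ true) (sym eq) ends)) (no-early-target i ij))

        at-injective : ∀ i j → i ≤ len → j ≤ len → at i ≡ at j → i ≡ j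
        at-injective i j il jl eq with <-cmp i j
        ... | tri< ij _ _ = ⊥-elim (distinct≤ i j ij jl eq)
        ... | tri≈ _ e _ = e
        ... | tri> _ _ ji = ⊥-elim (distinct≤ j i ji il (sym eq))

        consecutive< : ∀ i j → i < j → j ≤ len → Adj N (at i) (at j) ≡ true → j ≡ suc i
        consecutive< i j ij jl a with m≤n⇒m<n∨m≡n ij
        ... | inj₁ ij' = ⊥-elim (true≢false (trans (sym a) (no-chord i j ij' jl)))
        ... | inj₂ e = sym e

        consecutive : ∀ i j → i ≤ len → j ≤ len → Adj N (at i) (at j) ≡ true → j ≡ suc i ⊎ i ≡ suc j
        consecutive i j il jl a with <-cmp i j
        ... | tri< ij _ _ = inj₁ (consecutive< i j ij jl a)
        ... | tri≈ _ refl _ = ⊥-elim (true≢false (trans (sym a) (Adj-irrefl (at i))))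
        ... | tri> _ _ ji = inj₂ (consecutive< j i ji il (Adj-sym a))

        v-adjacent-ends : ∀ i → i ≤ len → Adj N v (at i) ≡ true → i ≡ 0 ⊎ i ≡ len
        v-adjacent-ends zero il a = inj₁ refl
        v-adjacent-ends (suc i) il a with m≤n⇒m<n∨m≡n il
        ... | inj₂ e = inj₂ e
        ... | inj₁ lt with at-injective (suc i) 0 il z≤n
                (trans (eqF-sound _ _ (non-target-neighbour (at (suc i)) a (no-early-target (suc i) lt)))
                       (sym starts))
        ... | ()

        v-start : Adj N v (at 0) ≡ true
        v-start = subst (λ z → Adj N v z ≡ true) (sym starts) vc

        v-end : Adj N v (at len) ≡ true
        v-end = ∧-fst ends

        member : Fin k → Bool
        member u = eqF u v ∨ anyℕ (suc len) (λ t → eqF u (at t))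

        S : Subset k
        S = tabulate member

        lookup-S : ∀ u → lookup S u ≡ member u
        lookup-S u = lookup∘tabulate member u

        member-v : member v ≡ true
        member-v rewrite eqF-refl v = refl

        member-at : ∀ t → t ≤ len → member (at t) ≡ true
        member-at t tl = ∨-inr {eqF (at t) v} (anyℕ-complete (suc len) _ t (s≤s tl) (eqF-refl (at t)))

        member-cases : ∀ u → member u ≡ true → u ≡ v ⊎ Σ ℕ λ t → t ≤ len × u ≡ at t
        member-cases u m with eqF u v in e
        ... | true = inj₁ (eqF-sound u v e)
        ... | false with anyℕ-sound (suc len) _ m
        ... | t , tl , q = inj₂ (t , ≤-pred tl , eqF-sound _ _ q)

        into-S : ∀ {u} → member u ≡ true → u ∈ S
        into-S {u} m = lookup⇒[]= _ _ (trans (lookup-S u) m)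

        from-S : ∀ {u} → u ∈ S → member u ≡ true
        from-S {u} m = trans (sym (lookup-S u)) ([]=⇒lookup m)

        neighbour-in : ∀ {a u} → member a ≡ true → Adj N a u ≡ true → (Adj N a u ∧ lookup S a) ≡ true
        neighbour-in {a} m e = ∧-intro e (trans (lookup-S a) m)

        neighbour-out : ∀ {a u} → (Adj N a u ∧ lookup S a) ≡ true → Adj N a u ≡ true × member a ≡ true
        neighbour-out {a} {u} e = ∧-fst e , trans (sym (lookup-S a)) (∧-snd {Adj N a u} e)

        degree-v : degIn N S v ≡ 2
        degree-v = count-two k _ (at 0) (at len)
          (λ e → len≢0 (sym (at-injective 0 len z≤n ≤-refl e)))
          (neighbour-in (member-at 0 z≤n) (Adj-sym v-start))
          (neighbour-in (member-at len ≤-refl) (Adj-sym v-end)) only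
          where
          only : ∀ w → (Adj N w v ∧ lookup S w) ≡ true → w ≡ at 0 ⊎ w ≡ at len
          only w e with neighbour-out {w} e
          ... | a , m with member-cases w m
          ... | inj₁ refl = ⊥-elim (true≢false (trans (sym a) (Adj-irrefl v)))
          ... | inj₂ (t , tl , refl) with v-adjacent-ends t tl (Adj-sym a)
          ... | inj₁ refl = inj₁ refl
          ... | inj₂ refl = inj₂ refl

        degree-start : degIn N S (at 0) ≡ 2
        degree-start = count-two k _ v (at 1) (λ e → avoids 1 (sym e))
          (neighbour-in member-v v-start) (neighbour-in (member-at 1 1≤len) (Adj-sym (steps 0 1≤len))) only
          where
          only : ∀ w → (Adj N w (at 0) ∧ lookup S w) ≡ true → w ≡ v ⊎ w ≡ at 1
          only w e with neighbour-out {w} e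
          ... | a , m with member-cases w m
          ... | inj₁ refl = inj₁ refl
          ... | inj₂ (t , tl , refl) with consecutive t 0 tl z≤n a
          ... | inj₂ refl = inj₂ refl

        degree-end : ∀ i → suc i ≡ len → degIn N S (at (suc i)) ≡ 2
        degree-end i refl = count-two k _ (at i) v (avoids i)
          (neighbour-in (member-at i (n≤1+n i)) (steps i ≤-refl)) (neighbour-in member-v v-end) only
          where
          only : ∀ w → (Adj N w (at (suc i)) ∧ lookup S w) ≡ true → w ≡ at i ⊎ w ≡ v
          only w e with neighbour-out {w} e
          ... | a , m with member-cases w m
          ... | inj₁ refl = inj₂ refl
          ... | inj₂ (t , tl , refl) with consecutive t (suc i) tl ≤-refl a
          ... | inj₁ refl = inj₁ refl
          ... | inj₂ refl = ⊥-elim (1+n≰n tl)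

        degree-inner : ∀ i → suc i < len → degIn N S (at (suc i)) ≡ 2
        degree-inner i lt = count-two k _ (at i) (at (suc (suc i)))
          (λ e → <-irrefl (at-injective i (suc (suc i)) i≤len lt e) (≤-trans (n<1+n i) (n≤1+n (suc i))))
          (neighbour-in (member-at i i≤len) (steps i (<⇒≤ lt)))
          (neighbour-in (member-at (suc (suc i)) lt) (Adj-sym (steps (suc i) lt))) only
          where
          i≤len : i ≤ len
          i≤len = ≤-trans (n≤1+n i) (<⇒≤ lt)
          only : ∀ w → (Adj N w (at (suc i)) ∧ lookup S w) ≡ true → w ≡ at i ⊎ w ≡ at (suc (suc i))
          only w e with neighbour-out {w} e
          ... | a , m with member-cases w m
          ... | inj₁ refl with v-adjacent-ends (suc i) (<⇒≤ lt) a
          ... | inj₂ refl = ⊥-elim (<-irrefl refl lt)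
          only w e | a , m | inj₂ (t , tl , refl) with consecutive t (suc i) tl (<⇒≤ lt) a
          ... | inj₁ refl = inj₁ refl
          ... | inj₂ refl = inj₂ refl

        degree : ∀ u → u ∈ S → degIn N S u ≡ 2
        degree u um with member-cases u (from-S um)
        ... | inj₁ refl = degree-v
        ... | inj₂ (zero , _ , refl) = degree-start
        ... | inj₂ (suc i , il , refl) with m≤n⇒m<n∨m≡n il
        ... | inj₁ lt = degree-inner i lt
        ... | inj₂ e = degree-end i e

        _++ᵘ_ : ∀ {a b d} → UPath N S a b → UPath N S b d → UPath N S a d
        here ++ᵘ q = q
        step e m r ++ᵘ q = step e m (r ++ᵘ q)

        to-v : ∀ i → i ≤ len → UPath N S (at i) v
        to-v zero _ = step (Adj-sym v-start) (into-S member-v) here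
        to-v (suc i) il =
          step (Adj-sym (steps i il)) (into-S (member-at i (≤-trans (n≤1+n i) il))) (to-v i (≤-trans (n≤1+n i) il))

        from-v : ∀ j → j ≤ len → UPath N S v (at j)
        from-v zero _ = step v-start (into-S (member-at 0 z≤n)) here
        from-v (suc j) jl = from-v j (≤-trans (n≤1+n j) jl) ++ᵘ step (steps j jl) (into-S (member-at (suc j) jl)) here

        connected : ∀ a b → a ∈ S → b ∈ S → UPath N S a b
        connected a b am bm with member-cases a (from-S am) | member-cases b (from-S bm)
        ... | inj₁ refl | inj₁ refl = here
        ... | inj₁ refl | inj₂ (j , jl , refl) = from-v j jl
        ... | inj₂ (i , il , refl) | inj₁ refl = to-v i il
        ... | inj₂ (i , il , refl) | inj₂ (j , jl , refl) = to-v i il ++ᵘ from-v j jl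

        -- v, at 0 and at len are three distinct members
        size : 3 ≤ ∣ S ∣
        size = subst (3 ≤_) (sym (∣∣-as-count S))
          (count-three≤ k (lookup S) v (at 0) (at len) (λ e → avoids 0 (sym e)) (λ e → avoids len (sym e))
            (λ e → len≢0 (sym (at-injective 0 len z≤n ≤-refl e)))
            (trans (lookup-S v) member-v) (trans (lookup-S (at 0)) (member-at 0 z≤n))
            (trans (lookup-S (at len)) (member-at len ≤-refl)))

        is-cycle : IsCycle N S
        is-cycle = size , degree , connected

        v-neighbours : ∀ u → u ∈ S → Adj N v u ≡ true → u ≡ c ⊎ u ≡ at len
        v-neighbours u um a with member-cases u (from-S um)
        ... | inj₁ refl = ⊥-elim (true≢false (trans (sym a) (Adj-irrefl v)))
        ... | inj₂ (t , tl , refl) with v-adjacent-ends t tl a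
        ... | inj₁ refl = inj₁ starts
        ... | inj₂ refl = inj₂ refl

    cycle-through : ∀ v c b → Adj N v c ≡ true → Adj N v b ≡ true → ¬ b ≡ c →
      Walk (λ x → ¬ x ≡ v) c b →
      Σ (Subset k) λ S → Σ (Fin k) λ e → IsCycle N S × v ∈ S × c ∈ S ×
        (∀ u → u ∈ S → Adj N v u ≡ true → u ≡ c ⊎ u ≡ e)
    cycle-through v c b vc vb b≢c walk with make-chordless (suc (Path.len path)) path ≤-refl
      where
      open PathsAround v c
      path : Path
      path = fromWalk walk (∧-intro vb (not-false (eqF-≢ b c b≢c)))
    ... | w , ch = S , Path.at w (Path.len w) , is-cycle , into-S member-v
                 , subst (_∈ S) (Path.starts w) (into-S (member-at 0 z≤n)) , v-neighbours
      where open PathsAround v c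
            open InducedCycle w ch vc

    -- in a DAG, two children of v with a common descendant are joined by
    -- a walk avoiding v (down from one child, up to the other)
    walk-between-children : (∀ u w → E u w ≡ true → ¬ Reach N w u) →
      ∀ v c c' ℓ → E v c ≡ true → E v c' ≡ true → Reach N c ℓ → Reach N c' ℓ →
      Walk (λ x → ¬ x ≡ v) c c'
    walk-between-children acyclic v c c' ℓ e e' r r' =
      mapʷ (avoids-v c e) (fromReach r) ++ʷ reverseʷ (mapʷ (avoids-v c' e') (fromReach r'))
      where
      avoids-v : ∀ d → E v d ≡ true → ∀ {x} → Reach N d x → ¬ x ≡ v
      avoids-v d ed rx refl = acyclic v d ed rx

    Level1At : Fin k → Set
    Level1At v = ∀ S S' → IsCycle N S → IsCycle N S' → v ∈ S → v ∈ S' → S ≡ S'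

    -- If v lies on at most one cycle S₁, whose neighbours of v are among
    -- c and e, then every neighbour a of v joined to another neighbour b
    -- by a walk avoiding v is c or e: the cycle closed by that walk is S₁.
    linked-neighbour-on-cycle : ∀ v → Level1At v → ∀ S₁ c e → IsCycle N S₁ → v ∈ S₁ →
      (∀ u → u ∈ S₁ → Adj N v u ≡ true → u ≡ c ⊎ u ≡ e) →
      ∀ a b → Adj N v a ≡ true → Adj N v b ≡ true → ¬ b ≡ a → Walk (λ x → ¬ x ≡ v) a b →
      a ≡ c ⊎ a ≡ e
    linked-neighbour-on-cycle v level1 S₁ c e cyc₁ vS₁ only₁ a b va vb b≢a wab
      with cycle-through v a b va vb b≢a wab
    ... | S₂ , _ , cyc₂ , vS₂ , aS₂ , _ =
      only₁ a (subst (a ∈_) (sym (level1 S₁ S₂ cyc₁ cyc₂ vS₁ vS₂)) aS₂) va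

    -- A vertex on at most one cycle has no three distinct children c1, c2,
    -- c3 with c1 joined to c2 and to c3 by walks avoiding v: the cycle
    -- closed by the first walk would give v a third neighbour.
    no-three-linked-children : ∀ v → Level1At v → ∀ c1 c2 c3 →
      E v c1 ≡ true → E v c2 ≡ true → E v c3 ≡ true →
      ¬ c1 ≡ c2 → ¬ c1 ≡ c3 → ¬ c2 ≡ c3 →
      Walk (λ x → ¬ x ≡ v) c1 c2 → Walk (λ x → ¬ x ≡ v) c1 c3 → ⊥
    no-three-linked-children v level1 c1 c2 c3 e1 e2 e3 n12 n13 n23 w12 w13
      with cycle-through v c1 c2 (E⇒Adj e1) (E⇒Adj e2) (λ q → n12 (sym q)) w12
    ... | S₁ , e , cyc₁ , vS₁ , _ , only₁ with c2 ≟ e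
    ... | yes c2≡e = [ (λ q → n13 (sym q)) , (λ q → n23 (trans c2≡e (sym q))) ]
            (linked-neighbour-on-cycle v level1 S₁ c1 e cyc₁ vS₁ only₁ c3 c1 (E⇒Adj e3) (E⇒Adj e1) n13 (reverseʷ w13))
    ... | no c2≢e = [ (λ q → n12 (sym q)) , c2≢e ]
            (linked-neighbour-on-cycle v level1 S₁ c1 e cyc₁ vS₁ only₁ c2 c1 (E⇒Adj e2) (E⇒Adj e1) n12 (reverseʷ w12))

module Criteria where

  open Prelude
  open import Data.Bool using (Bool; true; false; T; not; _∧_; _∨_)
  open import Data.Nat using (ℕ; zero; suc; _≤_; _≡ᵇ_; _≤ᵇ_)
  open import Data.Nat.Properties using (≡ᵇ⇒≡; ≡⇒≡ᵇ; ≤⇒≤ᵇ; ≤ᵇ⇒≤)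
  open import Data.Fin using (Fin)
  open import Data.Fin.Subset using (Subset; _∈_; ∣_∣)
  open import Data.Maybe using (just)
  open import Data.Vec using (lookup)
  open import Data.Vec.Properties using (tabulate∘lookup; tabulate-cong; []=⇒lookup; lookup⇒[]=)
  open import Data.Product using (Σ; _×_; _,_)
  open import Data.Sum using (inj₁; inj₂)
  open import Data.Empty using (⊥; ⊥-elim)
  open import Relation.Nullary using (¬_)
  open import Relation.Binary.PropositionalEquality using (_≡_; refl; sym; trans; subst)

  module Decide {n : ℕ} (N : Net n) where
    open Net N

    reachesIn : ℕ → Fin k → Fin k → Bool
    reachesIn zero u w = eqF u w
    reachesIn (suc f) u w = eqF u w ∨ anyF k (λ z → E u z ∧ reachesIn f z w)

    reachesIn-sound : ∀ f u w → reachesIn f u w ≡ true → Reach N u w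
    reachesIn-sound zero u w e rewrite eqF-sound u w e = here
    reachesIn-sound (suc f) u w e with eqF u w in q
    ... | true rewrite eqF-sound u w q = here
    ... | false with anyF-sound k _ e
    ... | z , ez = step (∧-fst ez) (reachesIn-sound f z w (∧-snd {E u z} ez))

    reachesIn-refl : ∀ f u → reachesIn f u u ≡ true
    reachesIn-refl zero u = eqF-refl u
    reachesIn-refl (suc f) u rewrite eqF-refl u = refl

    -- k steps suffice, once the k-step relation is checked to be closed
    -- under taking one more edge
    closed : Bool
    closed = allF k λ u → allF k λ a → allF k λ b → not (reachesIn k u a ∧ E a b) ∨ reachesIn k u b

    module _ (cl : T closed) where
      reaches-complete : ∀ {u w} → Reach N u w → reachesIn k u w ≡ true
      reaches-complete {u} r = along r (reachesIn-refl k u)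
        where
        along : ∀ {a w} → Reach N a w → reachesIn k u a ≡ true → reachesIn k u w ≡ true
        along here r = r
        along (step {w = b} e rr) r =
          along rr (⇒-elim (allF²-sound k k _ (≡⇒T (allF-sound k _ cl u)) _ b) (∧-intro r e))

    below : Subset n → Fin k → Bool
    below Y w = allF n (λ x → not (lookup Y x) ∨ reachesIn k w (leaf x))

    below-sound : ∀ Y w → below Y w ≡ true → Below N Y w
    below-sound Y w e x xm = reachesIn-sound k w (leaf x) (⇒-elim (allF-sound n _ (≡⇒T e) x) ([]=⇒lookup xm))

    isLCA : Subset n → Fin k → Bool
    isLCA Y v = isInterior N v ∧ (below Y v ∧ allF k (λ w → not (E v w ∧ below Y w)))

    onlyLCA : Subset n → Fin k → Bool
    onlyLCA Y v = allF k (λ v' → not (isLCA Y v') ∨ eqF v' v)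

    module _ (cl : T closed) where
      below-complete : ∀ Y w → Below N Y w → below Y w ≡ true
      below-complete Y w bw = allF-complete n _ each
        where
        each : ∀ x → (not (lookup Y x) ∨ reachesIn k w (leaf x)) ≡ true
        each x with lookup Y x in lx
        ... | false = refl
        ... | true = reaches-complete cl (bw x (lookup⇒[]= _ _ lx))

      isLCA-sound : ∀ Y v → isLCA Y v ≡ true → IsLCA N Y v
      isLCA-sound Y v e = ∧-fst e , below-sound Y v (∧-fst (∧-snd {isInterior N v} e)) ,
        λ w ew bw → not-true (allF-sound k _ (≡⇒T (∧-snd {below Y v} (∧-snd {isInterior N v} e))) w)
          (∧-intro ew (below-complete Y w bw))

      isLCA-complete : ∀ Y v → IsLCA N Y v → isLCA Y v ≡ true
      isLCA-complete Y v (iv , bv , ch) = ∧-intro iv (∧-intro (below-complete Y v bv) (allF-complete k _ each))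
        where
        each : ∀ w → not (E v w ∧ below Y w) ≡ true
        each w with E v w in ew | below Y w in bw
        ... | false | _ = refl
        ... | true | false = refl
        ... | true | true = ⊥-elim (ch w ew (below-sound Y w bw))

      onlyLCA-sound : ∀ Y v → onlyLCA Y v ≡ true → ∀ v' → IsLCA N Y v' → v' ≡ v
      onlyLCA-sound Y v u v' l = eqF-sound v' v (⇒-elim (allF-sound k _ (≡⇒T u) v') (isLCA-complete Y v' l))

    lca-witness-by-check : T closed → (pairOf : Fin k → Subset n) →
      T (allF k (λ v → not (isIntNonHyb N v) ∨
                       ((2 ≤ᵇ ∣ pairOf v ∣) ∧ ((∣ pairOf v ∣ ≤ᵇ 3) ∧ isLCA (pairOf v) v)))) →
      ∀ v → T (isIntNonHyb N v) → Σ (Subset n) λ Y → 2 ≤ ∣ Y ∣ × ∣ Y ∣ ≤ 3 × IsLCA N Y v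
    lca-witness-by-check cl pairOf ch v p =
      pairOf v , ≤ᵇ⇒≤ 2 _ (≡⇒T (∧-fst h)) , ≤ᵇ⇒≤ _ 3 (≡⇒T (∧-fst (∧-snd {2 ≤ᵇ ∣ pairOf v ∣} h))) ,
      isLCA-sound cl (pairOf v) v (∧-snd {∣ pairOf v ∣ ≤ᵇ 3} (∧-snd {2 ≤ᵇ ∣ pairOf v ∣} h))
      where
      h : ((2 ≤ᵇ ∣ pairOf v ∣) ∧ ((∣ pairOf v ∣ ≤ᵇ 3) ∧ isLCA (pairOf v) v)) ≡ true
      h = ⇒-elim (allF-sound k _ ch v) (T⇒≡ p)

    Degree2 : Subset k → Set
    Degree2 S = ∀ u → lookup S u ≡ true → degIn N S u ≡ 2

    cycle-like : Subset k → Bool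
    cycle-like S = allF k (λ u → not (lookup S u) ∨ (degIn N S u ≡ᵇ 2)) ∧ anyF k (λ u → lookup S u)

    cycle-like-complete : ∀ S u → Degree2 S → lookup S u ≡ true → cycle-like S ≡ true
    cycle-like-complete S u deg su = ∧-intro (allF-complete k _ each) (anyF-complete k _ u su)
      where
      each : ∀ w → (not (lookup S w) ∨ (degIn N S w ≡ᵇ 2)) ≡ true
      each w with lookup S w in lw
      ... | false = refl
      ... | true = T⇒≡ (≡⇒≡ᵇ _ 2 (deg w lw))

    cycle⇒Degree2 : ∀ S → IsCycle N S → Degree2 S
    cycle⇒Degree2 S (_ , d , _) u su = d u (lookup⇒[]= _ _ su)

    no-cycle : T (allSubsets k (λ S → not (cycle-like S))) → ∀ S u → Degree2 S → lookup S u ≡ true → ⊥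
    no-cycle ch S u deg su = not-true (allSubsets-sound k _ ch S) (cycle-like-complete S u deg su)

    sameSubset : Subset k → Subset k → Bool
    sameSubset S C = allF k (λ u → lookup S u ⇔ᵇ lookup C u)

    only-cycle : ∀ C → T (allSubsets k (λ S → not (cycle-like S) ∨ sameSubset S C)) →
      ∀ S u → Degree2 S → lookup S u ≡ true → S ≡ C
    only-cycle C ch S u deg su =
      trans (sym (tabulate∘lookup S)) (trans (tabulate-cong same) (tabulate∘lookup C))
      where
      same : ∀ w → lookup S w ≡ lookup C w
      same w = ⇔ᵇ-sound _ _ (allF-sound k _ (≡⇒T (⇒-elim (allSubsets-sound k _ ch S)
                                                    (cycle-like-complete S u deg su))) w)

    level1-acyclic : T (allSubsets k (λ S → not (cycle-like S))) →
      ∀ v → isInterior N v ≡ true → ∀ S S' → IsCycle N S → IsCycle N S' → v ∈ S → v ∈ S' → S ≡ S'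
    level1-acyclic ch v _ S S' cS _ vS _ = ⊥-elim (no-cycle ch S v (cycle⇒Degree2 S cS) ([]=⇒lookup vS))

    level1-one-cycle : ∀ C → T (allSubsets k (λ S → not (cycle-like S) ∨ sameSubset S C)) →
      ∀ v → isInterior N v ≡ true → ∀ S S' → IsCycle N S → IsCycle N S' → v ∈ S → v ∈ S' → S ≡ S'
    level1-one-cycle C ch v _ S S' cS cS' vS vS' =
      trans (only-cycle C ch S v (cycle⇒Degree2 S cS) ([]=⇒lookup vS))
            (sym (only-cycle C ch S' v (cycle⇒Degree2 S' cS') ([]=⇒lookup vS')))

    noLoops : Bool
    noLoops = allF k (λ v → not (E v v))
    acyclic : Bool
    acyclic = allF k λ u → allF k λ w → not (E u w ∧ reachesIn k w u)
    isRoot : Fin k → Bool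
    isRoot r = (indeg N r ≡ᵇ 0) ∧ allF k (λ v → not (indeg N v ≡ᵇ 0) ∨ eqF v r)
    leafInjective : Bool
    leafInjective = allF n λ x → allF n λ y → not (eqF (leaf x) (leaf y)) ∨ eqF x y
    leavesAreLeaves : Bool
    leavesAreLeaves = allF n (λ x → isLeaf N (leaf x))
    leavesLabelled : Bool
    leavesLabelled = allF k (λ v → not (isLeaf N v) ∨ anyF n (λ x → eqF (leaf x) v))
    noSubdivision : Bool
    noSubdivision = allF k (λ v → not ((indeg N v ≡ᵇ 1) ∧ (outdeg N v ≡ᵇ 1)))

    phylogenetic : T closed → T noLoops → T acyclic → ∀ r → T (isRoot r) → T leafInjective →
      T leavesAreLeaves → T leavesLabelled → T noSubdivision → IsPhyloNet N
    phylogenetic cl nl ac r rt ij lf sj d1 =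
      ( (λ v → not-true⇒false (allF-sound k _ nl v))
      , (λ u w e rr → not-true (allF²-sound k k _ ac u w) (∧-intro e (reaches-complete cl rr)))
      , r , ≡ᵇ⇒≡ _ 0 (≡⇒T (∧-fst (T⇒≡ rt)))
      , (λ v e → eqF-sound v r (⇒-elim (allF-sound k _ (≡⇒T (∧-snd {indeg N r ≡ᵇ 0} (T⇒≡ rt))) v)
                                      (T⇒≡ (≡⇒≡ᵇ _ 0 e)))))
      , ( (λ {x} {y} e → eqF-sound x y (⇒-elim (allF²-sound n n _ ij x y)
                            (subst (λ z → eqF (leaf x) z ≡ true) e (eqF-refl (leaf x)))))
        , allF-sound n _ lf
        , (λ v lv → let (x , q) = anyF-sound n _ (⇒-elim (allF-sound k _ sj v) lv) in x , eqF-sound _ _ q))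
      , λ v (e1 , e2) → not-true (allF-sound k _ d1 v) (∧-intro (T⇒≡ (≡⇒≡ᵇ _ 1 e1)) (T⇒≡ (≡⇒≡ᵇ _ 1 e2)))

  iso-by-check : ∀ {n} (A B : Net n) (φ : Fin (Net.k A) → Fin (Net.k B)) (ψ : Fin (Net.k B) → Fin (Net.k A)) →
    T (allF (Net.k A) (λ x → eqF (ψ (φ x)) x)) → T (allF (Net.k B) (λ y → eqF (φ (ψ y)) y)) →
    T (allF (Net.k A) λ u → allF (Net.k A) λ v → Net.E B (φ u) (φ v) ⇔ᵇ Net.E A u v) →
    T (allF n (λ x → eqF (φ (Net.leaf A x)) (Net.leaf B x))) → NetIso A B
  iso-by-check {n} A B φ ψ c1 c2 c3 c4 = record
    { φ = φ ; ψ = ψ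
    ; ψφ = λ x → eqF-sound _ _ (allF-sound (Net.k A) _ c1 x)
    ; φψ = λ y → eqF-sound _ _ (allF-sound (Net.k B) _ c2 y)
    ; edge = λ u v → ⇔ᵇ-sound _ _ (allF²-sound (Net.k A) (Net.k A) _ c3 u v)
    ; onX = λ x → eqF-sound _ _ (allF-sound n _ c4 x) }

  module DecideLabelled {n : ℕ} {M : Set} (𝒩 : LNet n M) where
    open LNet 𝒩
    open Decide net

    represents-by-check : T closed → (lca : Subset n → Fin k) →
      T (allSubsets n (λ Y → not ((2 ≤ᵇ ∣ Y ∣) ∧ (∣ Y ∣ ≤ᵇ 3)) ∨
                            (isLCA Y (lca Y) ∧ (onlyLCA Y (lca Y) ∧ isIntNonHyb net (lca Y))))) →
      (δ : SymDiss n M) → (∀ Y → 2 ≤ ∣ Y ∣ → ∣ Y ∣ ≤ 3 → ∀ p → just (t (lca Y) p) ≡ δ Y) → Represents 𝒩 δ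
    represents-by-check cl lca ch δ labels Y s2 s3 =
      lca Y , isLCA-sound cl Y (lca Y) (∧-fst h) ,
      onlyLCA-sound cl Y (lca Y) (∧-fst (∧-snd {isLCA Y (lca Y)} h)) ,
      ≡⇒T (∧-snd {onlyLCA Y (lca Y)} (∧-snd {isLCA Y (lca Y)} h)) , labels Y s2 s3 _
      where
      h : (isLCA Y (lca Y) ∧ (onlyLCA Y (lca Y) ∧ isIntNonHyb net (lca Y))) ≡ true
      h = ⇒-elim (allSubsets-sound n _ ch Y) (∧-intro (T⇒≡ (≤⇒≤ᵇ s2)) (T⇒≡ (≤⇒≤ᵇ s3)))

    semi-discriminating-by-check : (r a b : Fin k) →
      T (allF k λ u → allF k λ v → not (E u v ∧ (isIntNonHyb net u ∧ isIntNonHyb net v)) ∨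
                                   (eqF u r ∧ (eqF v a ∨ eqF v b))) →
      (∀ p p' → ¬ t r p ≡ t a p') → (∀ p p' → ¬ t r p ≡ t b p') → SemiDiscriminating 𝒩
    semi-discriminating-by-check r a b ch ra rb u v e pu pv eq
      with ⇒-elim (allF²-sound k k _ ch u v) (∧-intro e (∧-intro (T⇒≡ pu) (T⇒≡ pv)))
    ... | h with eqF-sound u r (∧-fst h) | ∨-elim (eqF v a) (eqF v b) (∧-snd {eqF u r} h)
    ... | refl | inj₁ va rewrite eqF-sound v a va = ⊥-elim (ra pu pv eq)
    ... | refl | inj₂ vb rewrite eqF-sound v b vb = ⊥-elim (rb pu pv eq)

module Isomorphisms where

  open Prelude
  open import Data.Bool using (true; _∧_; _∨_)
  open import Data.Fin.Subset using (Subset)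
  open import Data.Vec using (lookup; tabulate)
  open import Data.Vec.Properties using (lookup∘tabulate; lookup⇒[]=)
  open import Data.Product using (_,_)
  open import Relation.Binary.PropositionalEquality using (_≡_; refl; sym; trans; cong; cong₂; subst)

  iso-refl : ∀ {n} (N : Net n) → NetIso N N
  iso-refl N = record { φ = λ x → x ; ψ = λ x → x ; ψφ = λ _ → refl ; φψ = λ _ → refl
                      ; edge = λ _ _ → refl ; onX = λ _ → refl }

  iso-sym : ∀ {n} {A B : Net n} → NetIso A B → NetIso B A
  iso-sym {n} {A} {B} i = record
    { φ = ψ ; ψ = φ ; ψφ = φψ ; φψ = ψφ
    ; edge = λ u v → trans (sym (edge (ψ u) (ψ v))) (cong₂ (Net.E B) (φψ u) (φψ v))
    ; onX = λ x → trans (cong ψ (sym (onX x))) (ψφ (Net.leaf A x)) }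
    where open NetIso i

  iso-trans : ∀ {n} {A B C : Net n} → NetIso A B → NetIso B C → NetIso A C
  iso-trans i j = record
    { φ = λ x → J.φ (I.φ x) ; ψ = λ y → I.ψ (J.ψ y)
    ; ψφ = λ x → trans (cong I.ψ (J.ψφ (I.φ x))) (I.ψφ x)
    ; φψ = λ y → trans (cong J.φ (I.φψ (J.ψ y))) (J.φψ y)
    ; edge = λ u v → trans (J.edge (I.φ u) (I.φ v)) (I.edge u v)
    ; onX = λ x → trans (cong J.φ (I.onX x)) (J.onX x) }
    where
    module I = NetIso i
    module J = NetIso j

  module Transport {n} {A B : Net n} (i : NetIso A B) where
    open NetIso i
    module A = Net A
    module B = Net B

    indeg-φ : ∀ u → indeg B (φ u) ≡ indeg A u
    indeg-φ u = trans (ΣF-reindex A.k B.k φ ψ ψφ φψ (λ x → ind (B.E x (φ u))))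
                      (ΣF-cong A.k (λ y → cong ind (edge y u)))

    outdeg-φ : ∀ u → outdeg B (φ u) ≡ outdeg A u
    outdeg-φ u = trans (ΣF-reindex A.k B.k φ ψ ψφ φψ (λ x → ind (B.E (φ u) x)))
                       (ΣF-cong A.k (λ y → cong ind (edge u y)))

    isInterior-φ : ∀ u → isInterior B (φ u) ≡ isInterior A u
    isInterior-φ u rewrite indeg-φ u | outdeg-φ u = refl

    E-ψ : ∀ x y → A.E (ψ x) (ψ y) ≡ B.E x y
    E-ψ x y = trans (sym (edge (ψ x) (ψ y))) (cong₂ B.E (φψ x) (φψ y))

    Reach-φ : ∀ {u w} → Reach A u w → Reach B (φ u) (φ w)
    Reach-φ here = here
    Reach-φ (step e r) = step (trans (edge _ _) e) (Reach-φ r)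

    Reach-ψ : ∀ {x y} → Reach B x y → Reach A (ψ x) (ψ y)
    Reach-ψ here = here
    Reach-ψ (step e r) = step (trans (E-ψ _ _) e) (Reach-ψ r)

    Below-φ : ∀ Y u → Below A Y u → Below B Y (φ u)
    Below-φ Y u b x xm = subst (Reach B (φ u)) (onX x) (Reach-φ (b x xm))

    Below-ψ : ∀ Y x → Below B Y x → Below A Y (ψ x)
    Below-ψ Y x b y ym = subst (Reach A (ψ x)) (trans (cong ψ (sym (onX y))) (ψφ _)) (Reach-ψ (b y ym))

    IsLCA-φ : ∀ Y u → IsLCA A Y u → IsLCA B Y (φ u)
    IsLCA-φ Y u (iu , bu , ch) = trans (isInterior-φ u) iu , Below-φ Y u bu ,
      λ x e bx → ch (ψ x) (trans (trans (sym (edge u (ψ x))) (cong (B.E (φ u)) (φψ x))) e) (Below-ψ Y x bx)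

    pull : Subset B.k → Subset A.k
    pull S = tabulate (λ y → lookup S (φ y))

    lookup-pull : ∀ S y → lookup (pull S) y ≡ lookup S (φ y)
    lookup-pull S y = lookup∘tabulate (λ y → lookup S (φ y)) y

    degIn-φ : ∀ S u → degIn B S (φ u) ≡ degIn A (pull S) u
    degIn-φ S u = trans (ΣF-reindex A.k B.k φ ψ ψφ φψ (λ x → ind (Adj B x (φ u) ∧ lookup S x)))
      (ΣF-cong A.k (λ y → cong ind (cong₂ _∧_ (cong₂ _∨_ (edge y u) (edge u y)) (sym (lookup-pull S y)))))

    cycle-pull : ∀ S → IsCycle B S → ∀ u → lookup (pull S) u ≡ true → degIn A (pull S) u ≡ 2
    cycle-pull S (_ , d , _) u e = trans (sym (degIn-φ S u)) (d (φ u) (lookup⇒[]= _ _ (trans (sym (lookup-pull S u)) e)))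

Yxy Yxz Yyz : Subset 3
Yxy = pair x₀ y₀
Yxz = pair x₀ z₀
Yyz = pair y₀ z₀

module HellyNecessary where

  open Cycles using (module Walks)
  open import Data.Bool.Properties using (T-irrelevant)
  open import Data.Bool using (true)
  open import Data.Nat using (_≤_; z≤n; s≤s)
  open import Data.Fin using (zero; suc)
  open import Data.Fin.Subset using (⊤; _∈_; ∣_∣)
  open import Data.Fin.Subset.Properties using (∈⊤)
  open import Data.Vec using ([]; _∷_; here; there)
  open import Data.Maybe using (Maybe; just)
  open import Data.Product using (_,_)
  open import Data.Sum using (inj₁; inj₂)
  open import Data.Empty using (⊥; ⊥-elim)
  open import Relation.Nullary using (¬_; yes; no)
  open import Relation.Binary.PropositionalEquality using (_≡_; refl; sym; trans; cong)
  open import Relation.Binary.Definitions using (DecidableEquality)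

  -- Let v be
  -- the lca of X.  If δ(X) differed from δ(Y) for each of the three pairs
  -- Y, then v would not be the lca of any pair, so each pair would lie
  -- below a child of v; these three children are distinct and pairwise
  -- share a leaf, contradicting no-three-linked-children.
  module _ {M : Set} (δ : SymDiss 3 M) (𝒩 : LNet 3 M) where
    open LNet 𝒩

    below-X : ∀ w → Reach net w (leaf zero) → Reach net w (leaf (suc zero)) →
      Reach net w (leaf (suc (suc zero))) → Below net ⊤ w
    below-X w r0 r1 r2 zero _ = r0
    below-X w r0 r1 r2 (suc zero) _ = r1
    below-X w r0 r1 r2 (suc (suc zero)) _ = r2

    not-all-pairs-differ : IsLevel1Rep 𝒩 δ →
      ¬ (δ ⊤ ≡ δ Yxy) → ¬ (δ ⊤ ≡ δ Yxz) → ¬ (δ ⊤ ≡ δ Yyz) → ⊥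
    not-all-pairs-differ ((((noLoop , acyclic , _) , _ , _) , level1) , rep) nxy nxz nyz
      with rep ⊤ (s≤s (s≤s z≤n)) (s≤s (s≤s (s≤s z≤n)))
    ... | v , (interior , below-v , no-child-below) , _ , pv , tv =
      some-child-below Yxy s2 s3 nxy λ c1 e1 b1 →
      some-child-below Yxz s2 s3 nxz λ c2 e2 b2 →
      some-child-below Yyz s2 s3 nyz λ c3 e3 b3 →
      no-three-linked-children v (level1 v interior) c1 c2 c3 e1 e2 e3
        (λ { refl → no-child-below c1 e1 (below-X c1 (b1 zero x∈) (b1 (suc zero) y∈) (b2 (suc (suc zero)) z∈)) })
        (λ { refl → no-child-below c1 e1 (below-X c1 (b1 zero x∈) (b1 (suc zero) y∈) (b3 (suc (suc zero)) z∈)) })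
        (λ { refl → no-child-below c2 e2 (below-X c2 (b2 zero x∈) (b3 (suc zero) y∈) (b2 (suc (suc zero)) z∈)) })
        (walk-between-children acyclic v c1 c2 (leaf zero) e1 e2 (b1 zero x∈) (b2 zero x∈))
        (walk-between-children acyclic v c1 c3 (leaf (suc zero)) e1 e3 (b1 (suc zero) y∈) (b3 (suc zero) y∈))
      where
      open Walks net noLoop
      s2 : 2 ≤ 2
      s2 = s≤s (s≤s z≤n)
      s3 : 2 ≤ 3
      s3 = s≤s (s≤s z≤n)
      x∈ : ∀ {b c} → zero ∈ (true ∷ b ∷ c ∷ [])
      x∈ = here
      y∈ : ∀ {a c} → suc zero ∈ (a ∷ true ∷ c ∷ [])
      y∈ = there here
      z∈ : ∀ {a b} → suc (suc zero) ∈ (a ∷ b ∷ true ∷ [])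
      z∈ = there (there here)

      -- if δ(Y) ≠ δ(X), then v is not the lca of Y, so not every child of
      -- v misses Y
      some-child-below : ∀ Y → 2 ≤ ∣ Y ∣ → ∣ Y ∣ ≤ 3 → ¬ (δ ⊤ ≡ δ Y) →
        ¬ (∀ w → E v w ≡ true → ¬ Below net Y w)
      some-child-below Y lo hi nY none with rep Y lo hi
      ... | u , _ , unique , pu , tu with unique v (interior , (λ x _ → below-v x ∈⊤) , none)
      ... | refl = nY (trans (sym tv) (trans (cong (λ q → just (t v q)) (T-irrelevant pv pu)) tu))

    helly-necessary : DecidableEquality (Maybe M) → IsLevel1Rep 𝒩 δ → Helly δ
    helly-necessary _≟_ r with δ ⊤ ≟ δ Yxy | δ ⊤ ≟ δ Yxz | δ ⊤ ≟ δ Yyz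
    ... | yes p | _     | _     = inj₁ p
    ... | no _  | yes p | _     = inj₂ (inj₁ p)
    ... | no _  | no _  | yes p = inj₂ (inj₂ p)
    ... | no a  | no b  | no c  = ⊥-elim (not-all-pairs-differ r a b c)

module Candidates where

  open Prelude
  open Criteria
  open Isomorphisms using (iso-refl)
  open import Data.Bool using (Bool; true; false; T; not; _∨_; if_then_else_)
  open import Data.Nat using (_≤_; s≤s)
  open import Data.Fin using (Fin; zero; suc)
  open import Data.Fin.Subset using (Subset; ∣_∣; ⊤; _∈_)
  open import Data.Vec using (lookup; []; _∷_)
  open import Data.Maybe using (Maybe; just)
  open import Data.Product using (Σ; _×_; _,_; proj₁; proj₂)
  open import Data.Sum using (inj₁; inj₂)
  open import Data.Empty using (⊥-elim)
  open import Relation.Nullary using (¬_)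
  open import Relation.Binary.PropositionalEquality using (_≡_; refl; sym; trans; cong₂; subst; module ≡-Reasoning)
  open import Function.Definitions using (Injective)

  -- The seven candidate networks on X = {x, y, z}: the fork, the three
  -- triplets x|yz, y|xz, z|xy and the three tricycles x||yz, y||xz, z||xy.
  data Shape : Set where
    fork triplet-x triplet-y triplet-z tricycle-x tricycle-y tricycle-z : Shape

  perm3 : Fin 3 → Fin 3 → Fin 3 → Fin 3 → Fin 3
  perm3 a b c zero = a
  perm3 a b c (suc zero) = b
  perm3 a b c (suc (suc zero)) = c

  f0 f1 f2 : Fin 3
  f0 = zero
  f1 = suc zero
  f2 = suc (suc zero)

  placement : Shape → Fin 3 → Fin 3
  placement fork = perm3 f0 f1 f2
  placement triplet-x = perm3 f0 f1 f2
  placement triplet-y = perm3 f1 f0 f2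
  placement triplet-z = perm3 f2 f1 f0
  placement tricycle-x = perm3 f0 f1 f2
  placement tricycle-y = perm3 f1 f0 f2
  placement tricycle-z = perm3 f2 f1 f0

  base : Shape → Net 3
  base fork = Fork
  base triplet-x = Triplet
  base triplet-y = Triplet
  base triplet-z = Triplet
  base tricycle-x = Tricycle
  base tricycle-y = Tricycle
  base tricycle-z = Tricycle

  network : Shape → Net 3
  network K = permute (placement K) (base K)

  -- The pattern of a shape: for which pairs Y the lca of Y is the root,
  -- i.e. δ(Y) = δ(X) in any representation.  Distinct shapes have
  -- distinct patterns, and the pattern false/false/false never occurs:
  -- that is exactly the failure of the Helly property.
  root-xy root-xz root-yz : Shape → Bool
  root-xy fork = true
  root-xy triplet-x = true
  root-xy triplet-y = true
  root-xy triplet-z = false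
  root-xy tricycle-x = false
  root-xy tricycle-y = false
  root-xy tricycle-z = true
  root-xz fork = true
  root-xz triplet-x = true
  root-xz triplet-y = false
  root-xz triplet-z = true
  root-xz tricycle-x = false
  root-xz tricycle-y = true
  root-xz tricycle-z = false
  root-yz fork = true
  root-yz triplet-x = false
  root-yz triplet-y = true
  root-yz triplet-z = true
  root-yz tricycle-x = true
  root-yz tricycle-y = false
  root-yz tricycle-z = false

  shape-of-pattern : Bool → Bool → Bool → Shape
  shape-of-pattern true true true = fork
  shape-of-pattern true true false = triplet-x
  shape-of-pattern true false true = triplet-y
  shape-of-pattern false true true = triplet-z
  shape-of-pattern false false true = tricycle-x
  shape-of-pattern false true false = tricycle-y
  shape-of-pattern true false false = tricycle-z
  shape-of-pattern false false false = fork

  shape-of-pattern-inverse : ∀ K → shape-of-pattern (root-xy K) (root-xz K) (root-yz K) ≡ K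
  shape-of-pattern-inverse fork = refl
  shape-of-pattern-inverse triplet-x = refl
  shape-of-pattern-inverse triplet-y = refl
  shape-of-pattern-inverse triplet-z = refl
  shape-of-pattern-inverse tricycle-x = refl
  shape-of-pattern-inverse tricycle-y = refl
  shape-of-pattern-inverse tricycle-z = refl

  module _ {M : Set} where
    Compare : Bool → Maybe M → Maybe M → Set
    Compare true u w = u ≡ w
    Compare false u w = ¬ u ≡ w

    Compare-unique : ∀ b b' u w → Compare b u w → Compare b' u w → b ≡ b'
    Compare-unique true true u w _ _ = refl
    Compare-unique false false u w _ _ = refl
    Compare-unique true false u w e n = ⊥-elim (n e)
    Compare-unique false true u w n e = ⊥-elim (n e)

    Fits : Shape → SymDiss 3 M → Set
    Fits K δ = Compare (root-xy K) (δ Yxy) (δ ⊤) × Compare (root-xz K) (δ Yxz) (δ ⊤) ×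
               Compare (root-yz K) (δ Yyz) (δ ⊤)

    fits-unique : (δ : SymDiss 3 M) → ∀ K K' → Fits K δ → Fits K' δ → K ≡ K'
    fits-unique δ K K' (a , b , c) (a' , b' , c') = begin
      K                                                      ≡⟨ shape-of-pattern-inverse K ⟨
      shape-of-pattern (root-xy K) (root-xz K) (root-yz K)
        ≡⟨ cong₂ (λ p (qr : Bool × Bool) → shape-of-pattern p (proj₁ qr) (proj₂ qr))
                 (Compare-unique (root-xy K) (root-xy K') _ _ a a')
                 (cong₂ _,_ (Compare-unique (root-xz K) (root-xz K') _ _ b b')
                            (Compare-unique (root-yz K) (root-yz K') _ _ c c')) ⟩
      shape-of-pattern (root-xy K') (root-xz K') (root-yz K') ≡⟨ shape-of-pattern-inverse K' ⟩
      K'                                                     ∎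
      where open ≡-Reasoning

  -- The lcas in the candidate networks.  Vertex 0 is the root; in a
  -- triplet, vertex 1 is the lca of the cherry; in a tricycle, vertices
  -- 1 and 2 are the two parents of the hybrid vertex.
  Vertex : Shape → Set
  Vertex K = Fin (Net.k (network K))

  sameSubset : Subset 3 → Subset 3 → Bool
  sameSubset Y Y' = allF 3 (λ i → lookup Y i ⇔ᵇ lookup Y' i)

  lcaOf : (K : Shape) → Subset 3 → Vertex K
  lcaOf fork Y = zero
  lcaOf triplet-x Y = if sameSubset Y Yyz then suc zero else zero
  lcaOf triplet-y Y = if sameSubset Y Yxz then suc zero else zero
  lcaOf triplet-z Y = if sameSubset Y Yxy then suc zero else zero
  lcaOf tricycle-x Y = if sameSubset Y Yxy then suc zero else if sameSubset Y Yxz then suc (suc zero) else zero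
  lcaOf tricycle-y Y = if sameSubset Y Yxy then suc zero else if sameSubset Y Yyz then suc (suc zero) else zero
  lcaOf tricycle-z Y = if sameSubset Y Yyz then suc zero else if sameSubset Y Yxz then suc (suc zero) else zero

  pairOf : (K : Shape) → Vertex K → Subset 3
  pairOf fork _ = ⊤
  pairOf triplet-x (suc zero) = Yyz
  pairOf triplet-x _ = ⊤
  pairOf triplet-y (suc zero) = Yxz
  pairOf triplet-y _ = ⊤
  pairOf triplet-z (suc zero) = Yxy
  pairOf triplet-z _ = ⊤
  pairOf tricycle-x (suc zero) = Yxy
  pairOf tricycle-x (suc (suc zero)) = Yxz
  pairOf tricycle-x _ = ⊤
  pairOf tricycle-y (suc zero) = Yxy
  pairOf tricycle-y (suc (suc zero)) = Yyz
  pairOf tricycle-y _ = ⊤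
  pairOf tricycle-z (suc zero) = Yyz
  pairOf tricycle-z (suc (suc zero)) = Yxz
  pairOf tricycle-z _ = ⊤

  -- the unique cycle of a tricycle: root, its two children and the hybrid
  tricycle-cycle : Subset 7
  tricycle-cycle = true ∷ true ∷ true ∷ true ∷ false ∷ false ∷ false ∷ []

  network-phylogenetic : ∀ K → IsPhyloNet (network K)
  network-phylogenetic fork = Decide.phylogenetic (network fork) _ _ _ zero _ _ _ _ _
  network-phylogenetic triplet-x = Decide.phylogenetic (network triplet-x) _ _ _ zero _ _ _ _ _
  network-phylogenetic triplet-y = Decide.phylogenetic (network triplet-y) _ _ _ zero _ _ _ _ _
  network-phylogenetic triplet-z = Decide.phylogenetic (network triplet-z) _ _ _ zero _ _ _ _ _
  network-phylogenetic tricycle-x = Decide.phylogenetic (network tricycle-x) _ _ _ zero _ _ _ _ _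
  network-phylogenetic tricycle-y = Decide.phylogenetic (network tricycle-y) _ _ _ zero _ _ _ _ _
  network-phylogenetic tricycle-z = Decide.phylogenetic (network tricycle-z) _ _ _ zero _ _ _ _ _

  network-level1 : ∀ K → IsLevel1 (network K)
  network-level1 K = network-phylogenetic K , cycles K
    where
    cycles : ∀ K → ∀ v → isInterior (network K) v ≡ true → ∀ S S' →
      IsCycle (network K) S → IsCycle (network K) S' → v ∈ S → v ∈ S' → S ≡ S'
    cycles fork = Decide.level1-acyclic (network fork) _
    cycles triplet-x = Decide.level1-acyclic (network triplet-x) _
    cycles triplet-y = Decide.level1-acyclic (network triplet-y) _
    cycles triplet-z = Decide.level1-acyclic (network triplet-z) _
    cycles tricycle-x = Decide.level1-one-cycle (network tricycle-x) tricycle-cycle _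
    cycles tricycle-y = Decide.level1-one-cycle (network tricycle-y) tricycle-cycle _
    cycles tricycle-z = Decide.level1-one-cycle (network tricycle-z) tricycle-cycle _

  injective-by-check : (π : Fin 3 → Fin 3) →
    T (allF 3 λ x → allF 3 λ y → not (eqF (π x) (π y)) ∨ eqF x y) → Injective _≡_ _≡_ π
  injective-by-check π ch {x} {y} e =
    eqF-sound x y (⇒-elim (allF²-sound 3 3 (λ x y → not (eqF (π x) (π y)) ∨ eqF x y) ch x y) (subst (λ z → eqF (π x) z ≡ true) e (eqF-refl (π x))))

  network-standard : ∀ K → StandardShape (network K)
  network-standard fork = _ , injective-by-check _ _ , inj₁ (iso-refl _)
  network-standard triplet-x = _ , injective-by-check _ _ , inj₂ (inj₁ (iso-refl _))
  network-standard triplet-y = _ , injective-by-check _ _ , inj₂ (inj₁ (iso-refl _))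
  network-standard triplet-z = _ , injective-by-check _ _ , inj₂ (inj₁ (iso-refl _))
  network-standard tricycle-x = _ , injective-by-check _ _ , inj₂ (inj₂ (iso-refl _))
  network-standard tricycle-y = _ , injective-by-check _ _ , inj₂ (inj₂ (iso-refl _))
  network-standard tricycle-z = _ , injective-by-check _ _ , inj₂ (inj₂ (iso-refl _))

  lca-witness : ∀ K v → T (isIntNonHyb (network K) v) →
    Σ (Subset 3) λ Y → 2 ≤ ∣ Y ∣ × ∣ Y ∣ ≤ 3 × IsLCA (network K) Y v
  lca-witness fork = Decide.lca-witness-by-check (network fork) _ (pairOf fork) _
  lca-witness triplet-x = Decide.lca-witness-by-check (network triplet-x) _ (pairOf triplet-x) _
  lca-witness triplet-y = Decide.lca-witness-by-check (network triplet-y) _ (pairOf triplet-y) _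
  lca-witness triplet-z = Decide.lca-witness-by-check (network triplet-z) _ (pairOf triplet-z) _
  lca-witness tricycle-x = Decide.lca-witness-by-check (network tricycle-x) _ (pairOf tricycle-x) _
  lca-witness tricycle-y = Decide.lca-witness-by-check (network tricycle-y) _ (pairOf tricycle-y) _
  lca-witness tricycle-z = Decide.lca-witness-by-check (network tricycle-z) _ (pairOf tricycle-z) _

  by-cases : (P : Subset 3 → Set) → P Yxy → P Yxz → P Yyz → P ⊤ → ∀ Y → 2 ≤ ∣ Y ∣ → P Y
  by-cases P pxy pxz pyz pX (true ∷ true ∷ false ∷ []) _ = pxy
  by-cases P pxy pxz pyz pX (true ∷ false ∷ true ∷ []) _ = pxz
  by-cases P pxy pxz pyz pX (false ∷ true ∷ true ∷ []) _ = pyz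
  by-cases P pxy pxz pyz pX (true ∷ true ∷ true ∷ []) _ = pX
  by-cases P pxy pxz pyz pX (true ∷ false ∷ false ∷ []) (s≤s ())
  by-cases P pxy pxz pyz pX (false ∷ true ∷ false ∷ []) (s≤s ())
  by-cases P pxy pxz pyz pX (false ∷ false ∷ true ∷ []) (s≤s ())
  by-cases P pxy pxz pyz pX (false ∷ false ∷ false ∷ []) ()

  -- The candidates labelled by the values a = δ(x,y), b = δ(x,z),
  -- c = δ(y,z) and d = δ(x,y,z): the root carries d and the lca of a
  -- pair Y carries δ(Y).
  module Labelled {M : Set} (a b c d : M) where
    labelOf : (K : Shape) → Vertex K → M
    labelOf fork _ = d
    labelOf triplet-x (suc zero) = c
    labelOf triplet-x _ = d
    labelOf triplet-y (suc zero) = b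
    labelOf triplet-y _ = d
    labelOf triplet-z (suc zero) = a
    labelOf triplet-z _ = d
    labelOf tricycle-x (suc zero) = a
    labelOf tricycle-x (suc (suc zero)) = b
    labelOf tricycle-x _ = d
    labelOf tricycle-y (suc zero) = a
    labelOf tricycle-y (suc (suc zero)) = c
    labelOf tricycle-y _ = d
    labelOf tricycle-z (suc zero) = c
    labelOf tricycle-z (suc (suc zero)) = b
    labelOf tricycle-z _ = d

    labelled : Shape → LNet 3 M
    labelled K = record { net = network K ; t = λ v _ → labelOf K v }

    module _ (δ : SymDiss 3 M) (va : δ Yxy ≡ just a) (vb : δ Yxz ≡ just b)
             (vc : δ Yyz ≡ just c) (vd : δ ⊤ ≡ just d) where
      root-label : ∀ {Y} → δ Y ≡ δ ⊤ → just d ≡ δ Y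
      root-label f = trans (sym vd) (sym f)

      root-label-differs : ∀ {Y e} → δ Y ≡ just e → ¬ δ Y ≡ δ ⊤ → ¬ d ≡ e
      root-label-differs ve n refl = n (trans ve (sym vd))

      labels : ∀ K → Fits K δ → ∀ Y → 2 ≤ ∣ Y ∣ → just (labelOf K (lcaOf K Y)) ≡ δ Y
      labels fork (fxy , fxz , fyz) =
        by-cases _ (root-label fxy) (root-label fxz) (root-label fyz) (sym vd)
      labels triplet-x (fxy , fxz , _) =
        by-cases _ (root-label fxy) (root-label fxz) (sym vc) (sym vd)
      labels triplet-y (fxy , _ , fyz) =
        by-cases _ (root-label fxy) (sym vb) (root-label fyz) (sym vd)
      labels triplet-z (_ , fxz , fyz) =
        by-cases _ (sym va) (root-label fxz) (root-label fyz) (sym vd)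
      labels tricycle-x (_ , _ , fyz) =
        by-cases _ (sym va) (sym vb) (root-label fyz) (sym vd)
      labels tricycle-y (_ , fxz , _) =
        by-cases _ (sym va) (root-label fxz) (sym vc) (sym vd)
      labels tricycle-z (fxy , _ , _) =
        by-cases _ (root-label fxy) (sym vb) (sym vc) (sym vd)

      represents : ∀ K → Fits K δ → Represents (labelled K) δ
      represents K f = check K (labels K f)
        where
        check : ∀ K → (∀ Y → 2 ≤ ∣ Y ∣ → just (labelOf K (lcaOf K Y)) ≡ δ Y) → Represents (labelled K) δ
        check fork h = DecideLabelled.represents-by-check (labelled fork) _ (lcaOf fork) _ δ (λ Y s2 _ _ → h Y s2)
        check triplet-x h = DecideLabelled.represents-by-check (labelled triplet-x) _ (lcaOf triplet-x) _ δ (λ Y s2 _ _ → h Y s2)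
        check triplet-y h = DecideLabelled.represents-by-check (labelled triplet-y) _ (lcaOf triplet-y) _ δ (λ Y s2 _ _ → h Y s2)
        check triplet-z h = DecideLabelled.represents-by-check (labelled triplet-z) _ (lcaOf triplet-z) _ δ (λ Y s2 _ _ → h Y s2)
        check tricycle-x h = DecideLabelled.represents-by-check (labelled tricycle-x) _ (lcaOf tricycle-x) _ δ (λ Y s2 _ _ → h Y s2)
        check tricycle-y h = DecideLabelled.represents-by-check (labelled tricycle-y) _ (lcaOf tricycle-y) _ δ (λ Y s2 _ _ → h Y s2)
        check tricycle-z h = DecideLabelled.represents-by-check (labelled tricycle-z) _ (lcaOf tricycle-z) _ δ (λ Y s2 _ _ → h Y s2)

      -- the only edges between labelled vertices leave the root, towards
      -- the lca of a pair Y with δ(Y) ≠ δ(X)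
      semi-discriminating : ∀ K → Fits K δ → SemiDiscriminating (labelled K)
      semi-discriminating fork _ =
        DecideLabelled.semi-discriminating-by-check (labelled fork) zero (suc zero) (suc (suc zero)) _ (λ _ ()) (λ _ ())
      semi-discriminating triplet-x (_ , _ , fyz) =
        DecideLabelled.semi-discriminating-by-check (labelled triplet-x) zero (suc zero) (suc (suc zero)) _
          (λ _ _ → root-label-differs vc fyz) (λ _ ())
      semi-discriminating triplet-y (_ , fxz , _) =
        DecideLabelled.semi-discriminating-by-check (labelled triplet-y) zero (suc zero) (suc (suc zero)) _
          (λ _ _ → root-label-differs vb fxz) (λ _ ())
      semi-discriminating triplet-z (fxy , _ , _) =
        DecideLabelled.semi-discriminating-by-check (labelled triplet-z) zero (suc zero) (suc (suc zero)) _
          (λ _ _ → root-label-differs va fxy) (λ _ ())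
      semi-discriminating tricycle-x (fxy , fxz , _) =
        DecideLabelled.semi-discriminating-by-check (labelled tricycle-x) zero (suc zero) (suc (suc zero)) _
          (λ _ _ → root-label-differs va fxy) (λ _ _ → root-label-differs vb fxz)
      semi-discriminating tricycle-y (fxy , _ , fyz) =
        DecideLabelled.semi-discriminating-by-check (labelled tricycle-y) zero (suc zero) (suc (suc zero)) _
          (λ _ _ → root-label-differs va fxy) (λ _ _ → root-label-differs vc fyz)
      semi-discriminating tricycle-z (_ , fxz , fyz) =
        DecideLabelled.semi-discriminating-by-check (labelled tricycle-z) zero (suc zero) (suc (suc zero)) _
          (λ _ _ → root-label-differs vc fyz) (λ _ _ → root-label-differs vb fxz)

module Uniqueness where

  open Prelude
  open Criteria
  open Isomorphisms
  open Candidates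
  open import Data.Bool using (Bool; true; false; T; not; _∨_)
  open import Data.Nat using (ℕ; _≤_; z≤n; s≤s)
  open import Data.Fin using (Fin; zero; suc; #_)
  open import Data.Fin.Subset using (Subset; _∈_; ∣_∣; ⊤)
  open import Data.Vec using (lookup; []; _∷_)
  open import Data.Vec.Properties using ([]=⇒lookup; lookup⇒[]=)
  open import Data.Maybe using (Maybe; just)
  open import Data.Maybe.Properties using (just-injective)
  open import Data.Product using (Σ; _×_; _,_; proj₁)
  open import Data.Sum using (_⊎_; inj₁; inj₂)
  open import Data.Empty using (⊥; ⊥-elim)
  open import Data.Bool.Properties using (T-irrelevant)
  open import Relation.Nullary using (¬_)
  open import Relation.Binary.PropositionalEquality using (_≡_; refl; sym; trans; cong; subst; module ≡-Reasoning)

  -- Every network of standard shape is isomorphic to one of the seven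
  -- candidates: a permutation π of the leaves is one of six orderings, and
  -- for each the relabelled fork, triplet or tricycle is isomorphic to a
  -- candidate by an explicit vertex map.

  data Ordering : Fin 3 → Fin 3 → Fin 3 → Set where
    o012 : Ordering f0 f1 f2
    o021 : Ordering f0 f2 f1
    o102 : Ordering f1 f0 f2
    o120 : Ordering f1 f2 f0
    o201 : Ordering f2 f0 f1
    o210 : Ordering f2 f1 f0

  ordering : ∀ a b c → ¬ a ≡ b → ¬ a ≡ c → ¬ b ≡ c → Ordering a b c
  ordering zero (suc zero) (suc (suc zero)) _ _ _ = o012
  ordering zero (suc (suc zero)) (suc zero) _ _ _ = o021
  ordering (suc zero) zero (suc (suc zero)) _ _ _ = o102
  ordering (suc zero) (suc (suc zero)) zero _ _ _ = o120
  ordering (suc (suc zero)) zero (suc zero) _ _ _ = o201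
  ordering (suc (suc zero)) (suc zero) zero _ _ _ = o210
  ordering zero zero _ ab _ _ = ⊥-elim (ab refl)
  ordering (suc zero) (suc zero) _ ab _ _ = ⊥-elim (ab refl)
  ordering (suc (suc zero)) (suc (suc zero)) _ ab _ _ = ⊥-elim (ab refl)
  ordering zero (suc zero) zero _ ac _ = ⊥-elim (ac refl)
  ordering zero (suc zero) (suc zero) _ _ bc = ⊥-elim (bc refl)
  ordering zero (suc (suc zero)) zero _ ac _ = ⊥-elim (ac refl)
  ordering zero (suc (suc zero)) (suc (suc zero)) _ _ bc = ⊥-elim (bc refl)
  ordering (suc zero) zero zero _ _ bc = ⊥-elim (bc refl)
  ordering (suc zero) zero (suc zero) _ ac _ = ⊥-elim (ac refl)
  ordering (suc zero) (suc (suc zero)) (suc zero) _ ac _ = ⊥-elim (ac refl)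
  ordering (suc zero) (suc (suc zero)) (suc (suc zero)) _ _ bc = ⊥-elim (bc refl)
  ordering (suc (suc zero)) zero zero _ _ bc = ⊥-elim (bc refl)
  ordering (suc (suc zero)) zero (suc (suc zero)) _ ac _ = ⊥-elim (ac refl)
  ordering (suc (suc zero)) (suc zero) (suc zero) _ _ bc = ⊥-elim (bc refl)
  ordering (suc (suc zero)) (suc zero) (suc (suc zero)) _ ac _ = ⊥-elim (ac refl)

  perm3-values : (π : Fin 3 → Fin 3) → ∀ x → perm3 (π f0) (π f1) (π f2) x ≡ π x
  perm3-values π zero = refl
  perm3-values π (suc zero) = refl
  perm3-values π (suc (suc zero)) = refl

  permute-cong : (B : Net 3) (π π' : Fin 3 → Fin 3) → (∀ x → π x ≡ π' x) → NetIso (permute π B) (permute π' B)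
  permute-cong B π π' e = record { φ = λ x → x ; ψ = λ x → x ; ψφ = λ _ → refl ; φψ = λ _ → refl
                                 ; edge = λ _ _ → refl ; onX = λ x → cong (Net.leaf B) (e x) }

  fork-candidate : ∀ {a b c} → Ordering a b c → NetIso (network fork) (permute (perm3 a b c) Fork)
  fork-candidate o012 = iso-by-check _ _ (lookup (# 0 ∷ # 1 ∷ # 2 ∷ # 3 ∷ [])) (lookup (# 0 ∷ # 1 ∷ # 2 ∷ # 3 ∷ [])) _ _ _ _
  fork-candidate o021 = iso-by-check _ _ (lookup (# 0 ∷ # 1 ∷ # 3 ∷ # 2 ∷ [])) (lookup (# 0 ∷ # 1 ∷ # 3 ∷ # 2 ∷ [])) _ _ _ _
  fork-candidate o102 = iso-by-check _ _ (lookup (# 0 ∷ # 2 ∷ # 1 ∷ # 3 ∷ [])) (lookup (# 0 ∷ # 2 ∷ # 1 ∷ # 3 ∷ [])) _ _ _ _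
  fork-candidate o120 = iso-by-check _ _ (lookup (# 0 ∷ # 2 ∷ # 3 ∷ # 1 ∷ [])) (lookup (# 0 ∷ # 3 ∷ # 1 ∷ # 2 ∷ [])) _ _ _ _
  fork-candidate o201 = iso-by-check _ _ (lookup (# 0 ∷ # 3 ∷ # 1 ∷ # 2 ∷ [])) (lookup (# 0 ∷ # 2 ∷ # 3 ∷ # 1 ∷ [])) _ _ _ _
  fork-candidate o210 = iso-by-check _ _ (lookup (# 0 ∷ # 3 ∷ # 2 ∷ # 1 ∷ [])) (lookup (# 0 ∷ # 3 ∷ # 2 ∷ # 1 ∷ [])) _ _ _ _

  -- the identity and the vertex maps swapping the two cherry leaves of a
  -- triplet, resp. the two sides of a tricycle
  id₅ swap₅ : Fin 5 → Fin 5
  id₅ = lookup (# 0 ∷ # 1 ∷ # 2 ∷ # 3 ∷ # 4 ∷ [])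
  swap₅ = lookup (# 0 ∷ # 1 ∷ # 2 ∷ # 4 ∷ # 3 ∷ [])

  id₇ swap₇ : Fin 7 → Fin 7
  id₇ = lookup (# 0 ∷ # 1 ∷ # 2 ∷ # 3 ∷ # 4 ∷ # 5 ∷ # 6 ∷ [])
  swap₇ = lookup (# 0 ∷ # 2 ∷ # 1 ∷ # 3 ∷ # 4 ∷ # 6 ∷ # 5 ∷ [])

  triplet-candidate : ∀ {a b c} → Ordering a b c → Σ Shape λ K → NetIso (network K) (permute (perm3 a b c) Triplet)
  triplet-candidate o012 = triplet-x , iso-by-check _ _ id₅ id₅ _ _ _ _
  triplet-candidate o021 = triplet-x , iso-by-check _ _ swap₅ swap₅ _ _ _ _
  triplet-candidate o102 = triplet-y , iso-by-check _ _ id₅ id₅ _ _ _ _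
  triplet-candidate o120 = triplet-z , iso-by-check _ _ swap₅ swap₅ _ _ _ _
  triplet-candidate o201 = triplet-y , iso-by-check _ _ swap₅ swap₅ _ _ _ _
  triplet-candidate o210 = triplet-z , iso-by-check _ _ id₅ id₅ _ _ _ _

  tricycle-candidate : ∀ {a b c} → Ordering a b c → Σ Shape λ K → NetIso (network K) (permute (perm3 a b c) Tricycle)
  tricycle-candidate o012 = tricycle-x , iso-by-check _ _ id₇ id₇ _ _ _ _
  tricycle-candidate o021 = tricycle-x , iso-by-check _ _ swap₇ swap₇ _ _ _ _
  tricycle-candidate o102 = tricycle-y , iso-by-check _ _ id₇ id₇ _ _ _ _
  tricycle-candidate o120 = tricycle-z , iso-by-check _ _ swap₇ swap₇ _ _ _ _
  tricycle-candidate o201 = tricycle-y , iso-by-check _ _ swap₇ swap₇ _ _ _ _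
  tricycle-candidate o210 = tricycle-z , iso-by-check _ _ id₇ id₇ _ _ _ _

  standard-is-candidate : ∀ (N : Net 3) → StandardShape N → Σ Shape λ K → NetIso N (network K)
  standard-is-candidate N (π , injective , iso) = by-base iso
    where
    o : Ordering (π f0) (π f1) (π f2)
    o = ordering _ _ _ (λ e → f0≢f1 (injective e)) (λ e → f0≢f2 (injective e)) (λ e → f1≢f2 (injective e))
      where
      f0≢f1 : ¬ f0 ≡ f1
      f0≢f1 ()
      f0≢f2 : ¬ f0 ≡ f2
      f0≢f2 ()
      f1≢f2 : ¬ f1 ≡ f2
      f1≢f2 ()
    via : ∀ B K → NetIso N (permute π B) → NetIso (network K) (permute (perm3 (π f0) (π f1) (π f2)) B) →
      NetIso N (network K)
    via B K i j = iso-trans i (iso-sym (iso-trans j (permute-cong B _ π (perm3-values π))))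
    by-base : NetIso N (permute π Fork) ⊎ NetIso N (permute π Triplet) ⊎ NetIso N (permute π Tricycle) →
      Σ Shape λ K → NetIso N (network K)
    by-base (inj₁ i) = fork , via Fork fork i (fork-candidate o)
    by-base (inj₂ (inj₁ i)) with triplet-candidate o
    ... | K , j = K , via Triplet K i j
    by-base (inj₂ (inj₂ i)) with tricycle-candidate o
    ... | K , j = K , via Tricycle K i j

  -- Reading δ off a representation 𝒩' whose network is isomorphic (by θ)
  -- to a concrete network Q: sets with the same lca in Q have the same
  -- δ-value, and, if 𝒩' is semi-discriminating, sets whose lcas in Q are
  -- joined by an edge not leaving or entering a cycle have different ones.
  module ReadOff {n : ℕ} {M : Set} (δ : SymDiss n M) (𝒩' : LNet n M) (Q : Net n)
                 (θ : NetIso (LNet.net 𝒩') Q) (rep' : Represents 𝒩' δ) (closedQ : T (Decide.closed Q)) where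
    open LNet 𝒩'
    module θ = NetIso θ
    module Q = Net Q
    open Decide Q using (onlyLCA; onlyLCA-sound; cycle-like; cycle-like-complete; Degree2)

    lca-in-Q : ∀ Y (s2 : 2 ≤ ∣ Y ∣) (s3 : ∣ Y ∣ ≤ 3) (x : Fin Q.k) → onlyLCA Y x ≡ true →
      proj₁ (rep' Y s2 s3) ≡ θ.ψ x
    lca-in-Q Y s2 s3 x only with rep' Y s2 s3
    ... | u , lu , _ = trans (sym (θ.ψφ u)) (cong θ.ψ (onlyLCA-sound closedQ Y x only (θ.φ u) (Transport.IsLCA-φ θ Y u lu)))

    value-at : ∀ Y (s2 : 2 ≤ ∣ Y ∣) (s3 : ∣ Y ∣ ≤ 3) (x : Fin Q.k) → onlyLCA Y x ≡ true →
      Σ (T (isIntNonHyb net (θ.ψ x))) λ p → δ Y ≡ just (t (θ.ψ x) p)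
    value-at Y s2 s3 x only with rep' Y s2 s3 | lca-in-Q Y s2 s3 x only
    ... | u , _ , _ , pu , eu | refl = pu , sym eu

    same-lca : ∀ Y Y' (s2 : 2 ≤ ∣ Y ∣) (s3 : ∣ Y ∣ ≤ 3) (s2' : 2 ≤ ∣ Y' ∣) (s3' : ∣ Y' ∣ ≤ 3) x →
      onlyLCA Y x ≡ true → onlyLCA Y' x ≡ true → δ Y ≡ δ Y'
    same-lca Y Y' s2 s3 s2' s3' x o o' with value-at Y s2 s3 x o | value-at Y' s2' s3' x o'
    ... | p , e | p' , e' = trans e (trans (cong (λ q → just (t (θ.ψ x) q)) (T-irrelevant p p')) (sym e'))

    NotSeparated : Fin Q.k → Fin Q.k → Bool
    NotSeparated x x' = allSubsets Q.k (λ S → not (cycle-like S) ∨ (lookup S x ⇔ᵇ lookup S x'))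

    edge-between-lcas : SemiDiscriminating 𝒩' →
      ∀ Y Y' (s2 : 2 ≤ ∣ Y ∣) (s3 : ∣ Y ∣ ≤ 3) (s2' : 2 ≤ ∣ Y' ∣) (s3' : ∣ Y' ∣ ≤ 3) x x' →
      onlyLCA Y x ≡ true → onlyLCA Y' x' ≡ true → Q.E x x' ≡ true → T (NotSeparated x x') →
      ¬ δ Y ≡ δ Y'
    edge-between-lcas sd Y Y' s2 s3 s2' s3' x x' o o' xx' ns eq
      with value-at Y s2 s3 x o | value-at Y' s2' s3' x' o'
    ... | p , e | p' , e' with sd (θ.ψ x) (θ.ψ x') edge p p' (just-injective (trans (sym e) (trans eq e')))
      where edge = trans (Transport.E-ψ θ x x') xx'
    ... | C , cycle , separates = not-separated separates
      where
      module P = Transport (iso-sym θ)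
      S : Subset Q.k
      S = P.pull C
      lookup-C : ∀ w → ¬ w ∈ C → lookup C w ≡ false
      lookup-C w w∉ with lookup C w in e
      ... | false = refl
      ... | true = ⊥-elim (w∉ (lookup⇒[]= _ _ e))
      agree : ∀ w → lookup S w ≡ true → (lookup S x ⇔ᵇ lookup S x') ≡ true
      agree w sw = ⇒-elim (allSubsets-sound Q.k _ ns S) (cycle-like-complete S w (P.cycle-pull C cycle) sw)
      not-separated : ((θ.ψ x) ∈ C × ¬ (θ.ψ x') ∈ C) ⊎ (¬ (θ.ψ x) ∈ C × (θ.ψ x') ∈ C) → ⊥
      not-separated (inj₁ (in₁ , out₂)) with agree x (trans (P.lookup-pull C x) ([]=⇒lookup in₁))
      ... | h rewrite P.lookup-pull C x | P.lookup-pull C x' | []=⇒lookup in₁ | lookup-C _ out₂ with h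
      ... | ()
      not-separated (inj₂ (out₁ , in₂)) with agree x' (trans (P.lookup-pull C x') ([]=⇒lookup in₂))
      ... | h rewrite P.lookup-pull C x | P.lookup-pull C x' | []=⇒lookup in₂ | lookup-C _ out₁ with h
      ... | ()

  -- A semi-discriminating representation of δ whose network is isomorphic
  -- to the candidate K determines the pattern of δ: a pair has the same
  -- value as X iff its lca in K is the root.
  module _ {M : Set} (δ : SymDiss 3 M) (𝒩' : LNet 3 M) (rep' : Represents 𝒩' δ)
           (sd' : SemiDiscriminating 𝒩') where
    private
      s2 : 2 ≤ 2
      s2 = s≤s (s≤s z≤n)
      s3 : 2 ≤ 3
      s3 = s≤s (s≤s z≤n)

    module AtCandidate (K : Shape) (θ : NetIso (LNet.net 𝒩') (network K))
                       (closedK : T (Decide.closed (network K))) where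
      open ReadOff δ 𝒩' (network K) θ rep' closedK
      open Decide (network K) using (onlyLCA)

      agrees : ∀ Y → ∣ Y ∣ ≡ 2 → ∀ r → onlyLCA Y r ≡ true → onlyLCA ⊤ r ≡ true → δ Y ≡ δ ⊤
      agrees Y size r o oX =
        same-lca Y ⊤ (subst (2 ≤_) (sym size) s2) (subst (_≤ 3) (sym size) s3) s3 (s≤s s2) r o oX

      disagrees : ∀ Y → ∣ Y ∣ ≡ 2 → ∀ r x → onlyLCA ⊤ r ≡ true → onlyLCA Y x ≡ true →
        Net.E (network K) r x ≡ true → T (NotSeparated r x) → ¬ δ Y ≡ δ ⊤
      disagrees Y size r x oX o e ns eq =
        edge-between-lcas sd' ⊤ Y s3 (s≤s s2) (subst (2 ≤_) (sym size) s2) (subst (_≤ 3) (sym size) s3)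
          r x oX o e ns (sym eq)

    fits-of-representation : ∀ K → NetIso (LNet.net 𝒩') (network K) → Fits K δ
    fits-of-representation fork θ =
      agrees Yxy refl zero refl refl , agrees Yxz refl zero refl refl , agrees Yyz refl zero refl refl
      where open AtCandidate fork θ _
    fits-of-representation triplet-x θ =
      agrees Yxy refl zero refl refl , agrees Yxz refl zero refl refl ,
      disagrees Yyz refl zero (suc zero) refl refl refl _
      where open AtCandidate triplet-x θ _
    fits-of-representation triplet-y θ =
      agrees Yxy refl zero refl refl , disagrees Yxz refl zero (suc zero) refl refl refl _ ,
      agrees Yyz refl zero refl refl
      where open AtCandidate triplet-y θ _
    fits-of-representation triplet-z θ =
      disagrees Yxy refl zero (suc zero) refl refl refl _ , agrees Yxz refl zero refl refl ,
      agrees Yyz refl zero refl refl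
      where open AtCandidate triplet-z θ _
    fits-of-representation tricycle-x θ =
      disagrees Yxy refl zero (suc zero) refl refl refl _ ,
      disagrees Yxz refl zero (suc (suc zero)) refl refl refl _ , agrees Yyz refl zero refl refl
      where open AtCandidate tricycle-x θ _
    fits-of-representation tricycle-y θ =
      disagrees Yxy refl zero (suc zero) refl refl refl _ , agrees Yxz refl zero refl refl ,
      disagrees Yyz refl zero (suc (suc zero)) refl refl refl _
      where open AtCandidate tricycle-y θ _
    fits-of-representation tricycle-z θ =
      agrees Yxy refl zero refl refl , disagrees Yxz refl zero (suc (suc zero)) refl refl refl _ ,
      disagrees Yyz refl zero (suc zero) refl refl refl _
      where open AtCandidate tricycle-z θ _

  -- Two representations of δ with isomorphic networks are isomorphic as
  -- labelled networks, provided every labelled vertex of the first is an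
  -- lca: both label the lca of Y by δ(Y).
  labelled-iso : ∀ {n M} (δ : SymDiss n M) (𝒩 𝒩' : LNet n M) → Represents 𝒩 δ →
    (∀ v → T (isIntNonHyb (LNet.net 𝒩) v) → Σ (Subset n) λ Y → 2 ≤ ∣ Y ∣ × ∣ Y ∣ ≤ 3 × IsLCA (LNet.net 𝒩) Y v) →
    Represents 𝒩' δ → NetIso (LNet.net 𝒩) (LNet.net 𝒩') → LNetIso 𝒩 𝒩'
  labelled-iso δ 𝒩 𝒩' rep witness rep' σ = record { iso = σ ; label = same-label }
    where
    open NetIso σ
    module A = LNet 𝒩
    module B = LNet 𝒩'
    same-label : ∀ v (p : T (isIntNonHyb A.net v)) (p' : T (isIntNonHyb B.net (φ v))) → B.t (φ v) p' ≡ A.t v p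
    same-label v p p' with witness v p
    ... | Y , s2 , s3 , l with rep Y s2 s3 | rep' Y s2 s3
    ... | u , _ , unique , pu , eu | u' , _ , unique' , pu' , eu'
      with unique v l | unique' (φ v) (Transport.IsLCA-φ σ Y v l)
    ... | refl | refl = just-injective (begin
      just (B.t (φ v) p')  ≡⟨ cong (λ q → just (B.t (φ v) q)) (T-irrelevant p' pu') ⟩
      just (B.t (φ v) pu') ≡⟨ eu' ⟩
      δ Y                  ≡⟨ eu ⟨
      just (A.t v pu)      ≡⟨ cong (λ q → just (A.t v q)) (T-irrelevant pu p) ⟩
      just (A.t v p)       ∎)
      where open ≡-Reasoning

open HellyNecessary
open Candidates
open Uniqueness
open Isomorphisms using (iso-sym)

value-on : ∀ {n M} (δ : SymDiss n M) → IsSymDiss3 δ → ∀ Y → 2 ≤ ∣ Y ∣ → ∣ Y ∣ ≤ 3 → Σ M λ m → δ Y ≡ just m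
value-on δ δ-ok Y s2 s3 with δ Y in e
... | just m = m , refl
... | nothing = ⊥-elim (two≰one s2 (proj₁ (δ-ok Y (≤-trans (s≤s z≤n) s2) s3) e))
  where
  two≰one : ∀ {k} → 2 ≤ k → ¬ k ≡ 1
  two≰one (s≤s (s≤s _)) ()

fitting-shape : ∀ {M} (δ : SymDiss 3 M) → DecidableEquality (Maybe M) → Helly δ → Σ Shape λ K → Fits K δ
fitting-shape δ _≟_ helly with δ Yxy ≟ δ ⊤ | δ Yxz ≟ δ ⊤ | δ Yyz ≟ δ ⊤
... | yes a | yes b | yes c = fork , a , b , c
... | yes a | yes b | no c  = triplet-x , a , b , c
... | yes a | no b  | yes c = triplet-y , a , b , c
... | no a  | yes b | yes c = triplet-z , a , b , c
... | no a  | no b  | yes c = tricycle-x , a , b , c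
... | no a  | yes b | no c  = tricycle-y , a , b , c
... | yes a | no b  | no c  = tricycle-z , a , b , c
... | no a  | no b  | no c with helly
... | inj₁ e = ⊥-elim (a (sym e))
... | inj₂ (inj₁ e) = ⊥-elim (b (sym e))
... | inj₂ (inj₂ e) = ⊥-elim (c (sym e))

-- Under the Helly property, the candidate fitting δ, labelled by the
-- values of δ, is a semi-discriminating level-1 representation of
-- standard shape, and it is the only one up to isomorphism: any other
-- such representation is isomorphic to a candidate, whose pattern it
-- forces δ to have, so that candidate is the same one.
module _ {M : Set} (δ : SymDiss 3 M) (δ-ok : IsSymDiss3 δ) (_≟_ : DecidableEquality (Maybe M))
         (helly : Helly δ) where
  private
    2≤2 : 2 ≤ 2
    2≤2 = s≤s (s≤s z≤n)
    2≤3 : 2 ≤ 3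
    2≤3 = s≤s (s≤s z≤n)
    vxy : Σ M λ a → δ Yxy ≡ just a
    vxy = value-on δ δ-ok Yxy 2≤2 2≤3
    vxz : Σ M λ b → δ Yxz ≡ just b
    vxz = value-on δ δ-ok Yxz 2≤2 2≤3
    vyz : Σ M λ c → δ Yyz ≡ just c
    vyz = value-on δ δ-ok Yyz 2≤2 2≤3
    vX : Σ M λ d → δ ⊤ ≡ just d
    vX = value-on δ δ-ok ⊤ 2≤3 (s≤s 2≤2)
    K : Shape
    K = proj₁ (fitting-shape δ _≟_ helly)
    fits : Fits K δ
    fits = proj₂ (fitting-shape δ _≟_ helly)
  open Labelled (proj₁ vxy) (proj₁ vxz) (proj₁ vyz) (proj₁ vX)

  representation : LNet 3 M
  representation = labelled K

  representation-correct : IsLevel1Rep representation δ × SemiDiscriminating representation ×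
                           StandardShape (LNet.net representation)
  representation-correct =
    (network-level1 K , represents δ (proj₂ vxy) (proj₂ vxz) (proj₂ vyz) (proj₂ vX) K fits) ,
    semi-discriminating δ (proj₂ vxy) (proj₂ vxz) (proj₂ vyz) (proj₂ vX) K fits ,
    network-standard K

  representation-unique : ∀ 𝒩' → IsLevel1Rep 𝒩' δ → SemiDiscriminating 𝒩' →
    StandardShape (LNet.net 𝒩') → LNetIso representation 𝒩'
  representation-unique 𝒩' (_ , rep') sd' shape with standard-is-candidate (LNet.net 𝒩') shape
  ... | K' , θ with fits-unique δ K K' fits (fits-of-representation δ 𝒩' rep' sd' K' θ)
  ... | refl = labelled-iso δ representation 𝒩' (proj₂ (proj₁ representation-correct))
                 (lca-witness K) rep' (iso-sym θ)

lemma2 : ∀ (m : ℕ) → 2 ≤ m → (δ : SymDiss 3 (Fin m)) → IsSymDiss3 δ →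
    ((Σ (LNet 3 (Fin m)) λ 𝒩 → IsLevel1Rep 𝒩 δ) ⇔ Helly δ) ×
    (Helly δ →
      Σ (LNet 3 (Fin m)) λ 𝒩 →
        (IsLevel1Rep 𝒩 δ × SemiDiscriminating 𝒩 × StandardShape (LNet.net 𝒩)) ×
        (∀ 𝒩' → IsLevel1Rep 𝒩' δ → SemiDiscriminating 𝒩' →
           StandardShape (LNet.net 𝒩') → LNetIso 𝒩 𝒩'))
lemma2 m _ δ δ-ok =
  mk⇔ (λ (𝒩 , rep) → helly-necessary δ 𝒩 _≟_ rep)
      (λ helly → representation δ δ-ok _≟_ helly , proj₁ (representation-correct δ δ-ok _≟_ helly)) ,
  λ helly → representation δ δ-ok _≟_ helly ,
            representation-correct δ δ-ok _≟_ helly , representation-unique δ δ-ok _≟_ helly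
  where
  _≟_ : DecidableEquality (Maybe (Fin m))
  _≟_ = ≡-dec _≟-Fin_
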